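{- Let $G=(V,E)$ be a graph, let $W\subseteq V$ be its set of isolated vertices (vertices contained in no edge), and let $m=3|E|+2|W|$. Then $\mathrm{SSP}(G)\le_A \mathrm{TAP}_m$, where $\mathrm{TAP}_m$ is the three index assignment polytope on a ground set of size $m$.
   Context: For a graph $G=(V,E)$ with $V=\{v_1,\dots,v_k\}$, the stable set polytope $\mathrm{SSP}(G)$ is the convex hull of $\{y\in\{0,1\}^k : y_i+y_j\le 1 \text{ for every edge }\{v_i,v_j\}\in E\}$. For a finite ground set $S$ with $|S|=m$, the (axial) three index assignment polytope $\mathrm{TAP}_m$ is the convex hull of all $x\in\{0,1\}^{S\times S\times S}$ (coordinates $x(s,t,u)$) satisfying $\sum_{s,t\in S}x(s,t,u)=1$ for all $u\in S$, $\sum_{s,u\in S}x(s,t,u)=1$ for all $t\in S$, and $\sum_{t,u\in S}x(s,t,u)=1$ for all $s\in S$. For polytopes $p,q$, $p\le_A q$ means that $p$ is affinely equivalent (there is an affine bijection between their affine hulls mapping one onto the other) to $q$ or to a face of $q$.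
   Formalization: The polytopes $\mathrm{SSP}(G)$ and $\mathrm{TAP}_m$, their faces and the affine maps in $\le_A$ are taken over ℚ: points have rational coordinates, and maps and face-defining inequalities have rational coefficients. -}

module Defs where

open import Data.Nat as ℕ using (ℕ; zero; suc)
open import Data.Fin using (Fin; zero; suc; toℕ; combine)
open import Data.Fin.Properties using (_≟_)
open import Data.Rational using (ℚ; 0ℚ; 1ℚ; _+_; _*_; _≤_)
open import Data.List using (List; []; _∷_; length; filter)
open import Data.List.Relation.Unary.All using (All)
open import Data.List.Relation.Unary.Unique.Propositional using (Unique)
open import Data.List.Relation.Unary.Any using (any?)
open import Data.List using (allFin)
open import Data.Product using (Σ; _×_; _,_; proj₁; proj₂; ∃)
open import Data.Sum using (_⊎_)
open import Relation.Binary.PropositionalEquality using (_≡_)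
open import Relation.Nullary using (¬_)
open import Relation.Nullary.Decidable using (¬?; _⊎-dec_)

Pt : ℕ → Set
Pt n = Fin n → ℚ

sumFin : ∀ {n} → (Fin n → ℚ) → ℚ
sumFin {zero}  f = 0ℚ
sumFin {suc n} f = f zero + sumFin (λ i → f (suc i))

_≈ₚ_ : ∀ {n} → Pt n → Pt n → Set
x ≈ₚ y = ∀ i → x i ≡ y i

_·_ : ∀ {n} → Pt n → Pt n → ℚ
a · x = sumFin (λ i → a i * x i)

PtSet : ℕ → Set₁
PtSet n = Pt n → Set

combo : ∀ {n ℓ} → (Fin ℓ → ℚ) → (Fin ℓ → Pt n) → Pt n
combo w p i = sumFin (λ j → w j * p j i)

ConvHull : ∀ {n} → PtSet n → PtSet n
ConvHull {n} X y =
  Σ ℕ λ ℓ → Σ (Fin ℓ → ℚ) λ w → Σ (Fin ℓ → Pt n) λ p →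
    (∀ j → 0ℚ ≤ w j) × (sumFin w ≡ 1ℚ) × (∀ j → X (p j)) × (y ≈ₚ combo w p)

AffHull : ∀ {n} → PtSet n → PtSet n
AffHull {n} X y =
  Σ ℕ λ ℓ → Σ (Fin ℓ → ℚ) λ w → Σ (Fin ℓ → Pt n) λ p →
    (sumFin w ≡ 1ℚ) × (∀ j → X (p j)) × (y ≈ₚ combo w p)

affMap : ∀ {a b} → (Fin b → Fin a → ℚ) → Pt b → Pt a → Pt b
affMap A c x i = sumFin (λ j → A i j * x j) + c i

-- P and F are affinely equivalent: there is an affine map f (restricted
-- to aff P) which is a bijection aff P → aff F (with affine inverse g
-- on aff F) and maps P onto F.
AffEquiv : ∀ {a b} → PtSet a → PtSet b → Set
AffEquiv {a} {b} P F =
  Σ (Fin b → Fin a → ℚ) λ A → Σ (Pt b) λ c →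
  Σ (Fin a → Fin b → ℚ) λ B → Σ (Pt a) λ d →
    let f = affMap A c ; g = affMap B d in
    (∀ x → P x → F (f x)) ×
    (∀ y → F y → Σ (Pt a) λ x → P x × (f x ≈ₚ y)) ×
    (∀ x → AffHull P x → g (f x) ≈ₚ x) ×
    (∀ y → AffHull F y → f (g y) ≈ₚ y)

-- face of Q cut out by a valid inequality α·y ≤ β (includes Q itself, α = 0)
FaceBy : ∀ {b} → PtSet b → Pt b → ℚ → PtSet b
FaceBy Q α β y = Q y × (α · y ≡ β)

-- p ≤_A q : p is affinely equivalent to q or to a face of q
_≤A_ : ∀ {a b} → PtSet a → PtSet b → Set
_≤A_ {a} {b} P Q =
  Σ (Pt b) λ α → Σ ℚ λ β →
    (∀ y → Q y → α · y ≤ β) × AffEquiv P (FaceBy Q α β)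

-- Graphs: vertex set Fin k, edge list of pairs (i , j) with i < j,
-- without repetitions (a finite simple graph).

Edge : ℕ → Set
Edge k = Fin k × Fin k

IsSimpleGraph : ∀ {k} → List (Edge k) → Set
IsSimpleGraph E = All (λ e → toℕ (proj₁ e) ℕ.< toℕ (proj₂ e)) E × Unique E

Isolated : ∀ {k} → List (Edge k) → Fin k → Set
Isolated E v = All (λ e → ¬ (proj₁ e ≡ v ⊎ proj₂ e ≡ v)) E

numIsolated : ∀ {k} → List (Edge k) → ℕ
numIsolated {k} E =
  length (filter (λ v → ¬? (any? (λ e → (proj₁ e ≟ v) ⊎-dec (proj₂ e ≟ v)) E))
                 (allFin k))

StableVec : ∀ {k} → List (Edge k) → PtSet k
StableVec E y =
  (∀ i → y i ≡ 0ℚ ⊎ y i ≡ 1ℚ) ×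
  All (λ e → y (proj₁ e) + y (proj₂ e) ≤ 1ℚ) E

SSP : ∀ {k} → List (Edge k) → PtSet k
SSP E = ConvHull (StableVec E)

-- Three index assignment polytope on ground set Fin m;
-- coordinate x(s,t,u) is stored at index combine (combine s t) u.

idx3 : ∀ {m} → Fin m → Fin m → Fin m → Fin (m ℕ.* m ℕ.* m)
idx3 s t u = combine (combine s t) u

TAPVert : (m : ℕ) → PtSet (m ℕ.* m ℕ.* m)
TAPVert m x =
  (∀ i → x i ≡ 0ℚ ⊎ x i ≡ 1ℚ) ×
  (∀ u → sumFin {m} (λ s → sumFin {m} (λ t → x (idx3 {m} s t u))) ≡ 1ℚ) ×
  (∀ t → sumFin {m} (λ s → sumFin {m} (λ u → x (idx3 {m} s t u))) ≡ 1ℚ) ×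
  (∀ s → sumFin {m} (λ t → sumFin {m} (λ u → x (idx3 {m} s t u))) ≡ 1ℚ)

TAP : (m : ℕ) → PtSet (m ℕ.* m ℕ.* m)
TAP m = ConvHull (TAPVert m)

-- The ground set consists of a port for each of the 2|E| ends of edges, one element for each
-- edge and two elements for each isolated vertex. A stable set is sent to the assignment vertex
-- x(s, σ s, τ s) = 1 of two permutations: for each vertex v of the stable set, σ rotates the
-- cyclically ordered ports of v, and τ swaps each port of v with the element of its edge (and
-- the two elements of v, if v is isolated). Every coordinate of that vertex is one of 0, x_v,
-- 1 - x_v and 1 - x_a - x_b in the incidence vector x, so this is an affine map, and its image
-- lies in the face where all other coordinates vanish. Conversely, at a vertex of that face the
-- row and column sums through a port make the value read there invariant under the cyclic order,
-- hence a well-defined x_v; the remaining sums then determine the vertex as the image of x, and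
-- the coordinate 1 - x_a - x_b ≥ 0 of an edge ab says that x is stable.

module Submission where

open import Defs
open import Data.List using (List; length)

module _ where

  open import Algebra.Bundles using (Ring)
  open import Data.Bool using (Bool; true; false; if_then_else_)
  open import Data.Bool.Properties using (if-cong)
  open import Data.Empty using (⊥-elim)
  open import Data.Fin as Fin using (Fin; zero; suc; combine; remQuot; _<_; _↑ˡ_; _↑ʳ_; splitAt)
  open import Data.Fin.Induction using (<-wellFounded)
  open import Data.Fin.Permutation using (Permutation′; _⟨$⟩ʳ_; _⟨$⟩ˡ_; inverseˡ; inverseʳ)
  open import Data.Fin.Properties
    using (_≟_; remQuot-combine; combine-remQuot; <-cmp; +↔⊎;
           splitAt-↑ˡ; splitAt-↑ʳ; splitAt⁻¹-↑ˡ; splitAt⁻¹-↑ʳ)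
  open import Data.List using ([]; _∷_; foldr; map; lookup; filter; allFin)
  open import Data.List.Membership.Propositional using (_∈_; _∉_)
  open import Data.List.Membership.Propositional.Properties
    using (∈-lookup; ∈-filter⁺; ∈-filter⁻; ∈-allFin; ∈-map⁺)
  open import Data.List.Properties using (map-∘)
  open import Data.List.Relation.Unary.All as All using (All; []; _∷_)
  open import Data.List.Relation.Unary.AllPairs using ([]; _∷_)
  open import Data.List.Relation.Unary.Any as Any using (Any; here; there; any?; index)
  open import Data.List.Relation.Unary.Any.Properties using (lookup-index)
  open import Data.List.Relation.Unary.Unique.Propositional using (Unique)
  import Data.List.Relation.Unary.Unique.Propositional.Properties as Unique
  open import Data.Nat as ℕ using (ℕ)
  import Data.Nat.Properties as ℕ
  open import Data.Product using (Σ; _×_; _,_; proj₁; proj₂; uncurry)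
  open import Data.Product.Properties using (,-injective; ,-injectiveʳ) renaming (≡-dec to ×-≡-dec)
  open import Data.Rational using (ℚ; 0ℚ; 1ℚ; _+_; _*_; _-_; -_; 1/_; _≤_; ≢-nonZero; nonNegative)
  import Data.Rational.Properties as ℚ
  open import Data.Rational.Solver using (module +-*-Solver)
  open import Data.Sum as Sum using (_⊎_; inj₁; inj₂; [_,_]′)
  open import Data.Sum.Function.Propositional using (_⊎-↔_)
  open import Data.Sum.Properties using (inj₁-injective) renaming (≡-dec to ⊎-≡-dec)
  open import Function using (_∘_; id; case_of_)
  open import Function.Bundles using (Inverse; _↔_; mk↔ₛ′)
  open import Function.Properties.Inverse using (↔-refl; ↔-sym; ↔-trans)
  import Induction.WellFounded as WF
  open import Induction.WellFounded using (WfRec)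
  import Level
  open import Relation.Binary.Definitions using (DecidableEquality; tri<; tri≈; tri>)
  open import Relation.Binary.PropositionalEquality
  open import Relation.Nullary using (¬_; Dec; yes; no; does; _×-dec_; _⊎-dec_; ¬?)
  open import Relation.Nullary.Decidable using (dec-false; toWitnessFalse)
  open import Relation.Unary using (Decidable; _⊆_; _≐_)

  open import Algebra.Properties.Group ℚ.+-0-group using (x∙y⁻¹≈ε⇒x≈y)
  open import Algebra.Properties.Semiring.Sum (Ring.semiring ℚ.+-*-ring)
    using (sum; ∑-distrib-+; ∑-comm; *-distribˡ-sum; *-distribʳ-sum; sum-replicate-zero)

  cong₃ : ∀ {A B C D : Set} (h : A → B → C → D) {a a′ b b′ c c′} →
          a ≡ a′ → b ≡ b′ → c ≡ c′ → h a b c ≡ h a′ b′ c′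
  cong₃ h refl refl refl = refl

  sumFin≡sum : ∀ {n} (f : Fin n → ℚ) → sumFin f ≡ sum f
  sumFin≡sum {ℕ.zero}  f = refl
  sumFin≡sum {ℕ.suc n} f = cong (f zero +_) (sumFin≡sum (f ∘ suc))

  sumFin-cong : ∀ {n} {f g : Fin n → ℚ} → (∀ i → f i ≡ g i) → sumFin f ≡ sumFin g
  sumFin-cong {ℕ.zero}  f≗g = refl
  sumFin-cong {ℕ.suc n} f≗g = cong₂ _+_ (f≗g zero) (sumFin-cong (f≗g ∘ suc))

  sumFin-zero : ∀ {n} {f : Fin n → ℚ} → (∀ i → f i ≡ 0ℚ) → sumFin f ≡ 0ℚ
  sumFin-zero {n} f≗0 = trans (sumFin-cong f≗0) (trans (sumFin≡sum {n} _) (sum-replicate-zero n))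

  sumFin-distrib-+ : ∀ {n} (f g : Fin n → ℚ) → sumFin (λ i → f i + g i) ≡ sumFin f + sumFin g
  sumFin-distrib-+ {n} f g = begin
    sumFin (λ i → f i + g i)  ≡⟨ sumFin≡sum {n} _ ⟩
    sum (λ i → f i + g i)     ≡⟨ ∑-distrib-+ f g ⟩
    sum f + sum g             ≡⟨ sym (cong₂ _+_ (sumFin≡sum f) (sumFin≡sum g)) ⟩
    sumFin f + sumFin g       ∎
    where open ≡-Reasoning

  *-distribˡ-sumFin : ∀ {n} c (f : Fin n → ℚ) → c * sumFin f ≡ sumFin (λ i → c * f i)
  *-distribˡ-sumFin {n} c f =
    trans (cong (c *_) (sumFin≡sum f)) (trans (*-distribˡ-sum c f) (sym (sumFin≡sum {n} _)))

  *-distribʳ-sumFin : ∀ {n} c (f : Fin n → ℚ) → sumFin f * c ≡ sumFin (λ i → f i * c)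
  *-distribʳ-sumFin {n} c f =
    trans (cong (_* c) (sumFin≡sum f)) (trans (*-distribʳ-sum c f) (sym (sumFin≡sum {n} _)))

  sumFin-neg : ∀ {n} (f : Fin n → ℚ) → sumFin (λ i → - f i) ≡ - sumFin f
  sumFin-neg {ℕ.zero}  f = refl
  sumFin-neg {ℕ.suc n} f =
    trans (cong (- f zero +_) (sumFin-neg (f ∘ suc))) (sym (ℚ.neg-distrib-+ (f zero) _))

  sumFin-comm : ∀ {a b} (h : Fin a → Fin b → ℚ) →
    sumFin (λ i → sumFin (h i)) ≡ sumFin (λ j → sumFin (λ i → h i j))
  sumFin-comm h = begin
    sumFin (λ i → sumFin (h i))         ≡⟨ sumFin²≡sum² h ⟩
    sum (λ i → sum (h i))               ≡⟨ ∑-comm h ⟩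
    sum (λ j → sum (λ i → h i j))       ≡⟨ sym (sumFin²≡sum² (λ j i → h i j)) ⟩
    sumFin (λ j → sumFin (λ i → h i j)) ∎
    where
    open ≡-Reasoning
    sumFin²≡sum² : ∀ {a b} (h : Fin a → Fin b → ℚ) →
      sumFin (λ i → sumFin (h i)) ≡ sum (λ i → sum (h i))
    sumFin²≡sum² {a} h = trans (sumFin-cong (sumFin≡sum ∘ h)) (sumFin≡sum {a} _)

  0≤1 : 0ℚ ≤ 1ℚ
  0≤1 = ℚ.nonNegative⁻¹ 1ℚ

  2≰1 : ¬ (1ℚ + 1ℚ ≤ 1ℚ)
  2≰1 = toWitnessFalse {a? = (1ℚ + 1ℚ) ℚ.≤? 1ℚ} _

  nonpos-+-zero : ∀ {a b} → a ≤ 0ℚ → b ≤ 0ℚ → a + b ≡ 0ℚ → a ≡ 0ℚ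
  nonpos-+-zero {a} {b} a≤0 b≤0 a+b≡0 = ℚ.≤-antisym a≤0 (begin
    0ℚ     ≡⟨ sym a+b≡0 ⟩
    a + b  ≤⟨ ℚ.+-monoʳ-≤ a b≤0 ⟩
    a + 0ℚ ≡⟨ ℚ.+-identityʳ a ⟩
    a      ∎)
    where open ℚ.≤-Reasoning

  sumFin-nonneg : ∀ {n} {f : Fin n → ℚ} → (∀ i → 0ℚ ≤ f i) → 0ℚ ≤ sumFin f
  sumFin-nonneg {ℕ.zero}  f≥0 = ℚ.≤-refl
  sumFin-nonneg {ℕ.suc n} f≥0 = ℚ.+-mono-≤ (f≥0 zero) (sumFin-nonneg (f≥0 ∘ suc))

  sumFin-nonpos : ∀ {n} {f : Fin n → ℚ} → (∀ i → f i ≤ 0ℚ) → sumFin f ≤ 0ℚ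
  sumFin-nonpos {ℕ.zero}  f≤0 = ℚ.≤-refl
  sumFin-nonpos {ℕ.suc n} f≤0 = ℚ.+-mono-≤ (f≤0 zero) (sumFin-nonpos (f≤0 ∘ suc))

  sumFin-nonpos-zero : ∀ {n} {f : Fin n → ℚ} → (∀ i → f i ≤ 0ℚ) → sumFin f ≡ 0ℚ → ∀ i → f i ≡ 0ℚ
  sumFin-nonpos-zero {f = f} f≤0 Σf≡0 zero =
    nonpos-+-zero (f≤0 zero) (sumFin-nonpos (f≤0 ∘ suc)) Σf≡0
  sumFin-nonpos-zero {f = f} f≤0 Σf≡0 (suc i) =
    sumFin-nonpos-zero (f≤0 ∘ suc)
      (nonpos-+-zero (sumFin-nonpos (f≤0 ∘ suc)) (f≤0 zero)
        (trans (ℚ.+-comm _ (f zero)) Σf≡0)) i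

  𝟙 : ∀ {p} {P : Set p} → Dec P → ℚ
  𝟙 d = if does d then 1ℚ else 0ℚ

  𝟙-yes : ∀ {p} {P : Set p} (d : Dec P) → P → 𝟙 d ≡ 1ℚ
  𝟙-yes (yes _) _  = refl
  𝟙-yes (no ¬p) p = ⊥-elim (¬p p)

  𝟙-no : ∀ {p} {P : Set p} (d : Dec P) → ¬ P → 𝟙 d ≡ 0ℚ
  𝟙-no (yes p) ¬p = ⊥-elim (¬p p)
  𝟙-no (no _)  _  = refl

  𝟙-cong : ∀ {p q} {P : Set p} {Q : Set q} → (P → Q) → (Q → P) →
           (dp : Dec P) (dq : Dec Q) → 𝟙 dp ≡ 𝟙 dq
  𝟙-cong P→Q Q→P (yes p) dq = sym (𝟙-yes dq (P→Q p))
  𝟙-cong P→Q Q→P (no ¬p) dq = sym (𝟙-no dq (¬p ∘ Q→P))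

  𝟙-× : ∀ {p q} {P : Set p} {Q : Set q} (dp : Dec P) (dq : Dec Q) →
        𝟙 (dp ×-dec dq) ≡ 𝟙 dp * 𝟙 dq
  𝟙-× (yes _) (yes _) = refl
  𝟙-× (yes _) (no _)  = refl
  𝟙-× (no _)  dq      = sym (ℚ.*-zeroˡ (𝟙 dq))

  𝟙-01 : ∀ {p} {P : Set p} (d : Dec P) → 𝟙 d ≡ 0ℚ ⊎ 𝟙 d ≡ 1ℚ
  𝟙-01 (yes _) = inj₂ refl
  𝟙-01 (no _)  = inj₁ refl

  δ : ∀ {n} → Fin n → Fin n → ℚ
  δ i j = 𝟙 (i ≟ j)

  sumFin-δ : ∀ {n} (a : Fin n) (f : Fin n → ℚ) → sumFin (λ i → δ a i * f i) ≡ f a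
  sumFin-δ {ℕ.suc n} zero f = begin
    1ℚ * f zero + sumFin (λ i → 0ℚ * f (suc i)) ≡⟨ cong₂ _+_ (ℚ.*-identityˡ (f zero))
                                                     (sumFin-zero {n} (ℚ.*-zeroˡ ∘ f ∘ suc)) ⟩
    f zero + 0ℚ                                 ≡⟨ ℚ.+-identityʳ _ ⟩
    f zero                                      ∎
    where open ≡-Reasoning
  sumFin-δ {ℕ.suc n} (suc a) f =
    trans (cong (_+ sumFin (λ i → δ a i * f (suc i))) (ℚ.*-zeroˡ (f zero)))
          (trans (ℚ.+-identityˡ _) (sumFin-δ a (f ∘ suc)))

  sumFin-δ-one : ∀ {n} (a : Fin n) → sumFin (δ a) ≡ 1ℚ
  sumFin-δ-one a = trans (sumFin-cong (λ i → sym (ℚ.*-identityʳ (δ a i)))) (sumFin-δ a (λ _ → 1ℚ))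

  01⇒nonneg : ∀ {a} → a ≡ 0ℚ ⊎ a ≡ 1ℚ → 0ℚ ≤ a
  01⇒nonneg (inj₁ refl) = ℚ.≤-refl
  01⇒nonneg (inj₂ refl) = 0≤1

  nonneg*nonneg : ∀ {a b} → 0ℚ ≤ a → 0ℚ ≤ b → 0ℚ ≤ a * b
  nonneg*nonneg {a} {b} 0≤a 0≤b = begin
    0ℚ     ≡⟨ sym (ℚ.*-zeroʳ a) ⟩
    a * 0ℚ ≤⟨ ℚ.*-monoˡ-≤-nonNeg a {{nonNegative 0≤a}} 0≤b ⟩
    a * b  ∎
    where open ℚ.≤-Reasoning

  nonneg*nonpos≤0 : ∀ {a b} → 0ℚ ≤ a → b ≤ 0ℚ → a * b ≤ 0ℚ
  nonneg*nonpos≤0 {a} {b} 0≤a b≤0 = begin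
    a * b  ≤⟨ ℚ.*-monoˡ-≤-nonNeg a {{nonNegative 0≤a}} b≤0 ⟩
    a * 0ℚ ≡⟨ ℚ.*-zeroʳ a ⟩
    0ℚ     ∎
    where open ℚ.≤-Reasoning

  ≤⇒-≤0 : ∀ {a b} → a ≤ b → a - b ≤ 0ℚ
  ≤⇒-≤0 {a} {b} a≤b = ℚ.≤-trans (ℚ.+-monoˡ-≤ (- b) a≤b) (ℚ.≤-reflexive (ℚ.+-inverseʳ b))

  *-zero-cancelʳ : ∀ {a b} → a * b ≡ 0ℚ → b ≢ 0ℚ → a ≡ 0ℚ
  *-zero-cancelʳ {a} {b} ab≡0 b≢0 = begin
    a                ≡⟨ sym (ℚ.*-identityʳ a) ⟩
    a * 1ℚ           ≡⟨ cong (a *_) (sym (ℚ.*-inverseʳ b)) ⟩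
    a * (b * 1/b)    ≡⟨ sym (ℚ.*-assoc a b 1/b) ⟩
    (a * b) * 1/b    ≡⟨ cong (_* 1/b) ab≡0 ⟩
    0ℚ * 1/b         ≡⟨ ℚ.*-zeroˡ 1/b ⟩
    0ℚ               ∎
    where
    open ≡-Reasoning
    instance _ = ≢-nonZero b≢0
    1/b = 1/ b

  -- Convex and affine hulls

  dot-cong : ∀ {n} (a : Pt n) {x y : Pt n} → x ≈ₚ y → a · x ≡ a · y
  dot-cong a x≈y = sumFin-cong (cong (a _ *_) ∘ x≈y)

  affMap-cong : ∀ {a b} (A : Fin b → Fin a → ℚ) (c : Pt b) {x y : Pt a} →
                x ≈ₚ y → affMap A c x ≈ₚ affMap A c y
  affMap-cong A c x≈y i = cong (_+ c i) (dot-cong (A i) x≈y)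

  combo-cong : ∀ {n ℓ} (w : Fin ℓ → ℚ) {p q : Fin ℓ → Pt n} →
               (∀ j i → w j * p j i ≡ w j * q j i) → combo w p ≈ₚ combo w q
  combo-cong w wp≡wq i = sumFin-cong (λ j → wp≡wq j i)

  dot-combo : ∀ {n ℓ} (a : Pt n) (w : Fin ℓ → ℚ) (p : Fin ℓ → Pt n) →
              a · combo w p ≡ sumFin (λ j → w j * (a · p j))
  dot-combo a w p = begin
    sumFin (λ i → a i * sumFin (λ j → w j * p j i))
      ≡⟨ sumFin-cong (λ i → *-distribˡ-sumFin (a i) (λ j → w j * p j i)) ⟩
    sumFin (λ i → sumFin (λ j → a i * (w j * p j i)))
      ≡⟨ sumFin-comm (λ i j → a i * (w j * p j i)) ⟩
    sumFin (λ j → sumFin (λ i → a i * (w j * p j i)))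
      ≡⟨ sumFin-cong (λ j → sumFin-cong (λ i → swap (a i) (w j) (p j i))) ⟩
    sumFin (λ j → sumFin (λ i → w j * (a i * p j i)))
      ≡⟨ sumFin-cong (λ j → sym (*-distribˡ-sumFin (w j) (λ i → a i * p j i))) ⟩
    sumFin (λ j → w j * (a · p j)) ∎
    where
    open ≡-Reasoning
    open +-*-Solver
    swap : ∀ x y z → x * (y * z) ≡ y * (x * z)
    swap = solve 3 (λ x y z → x :* (y :* z) := y :* (x :* z)) refl

  weighted-sum-const : ∀ {ℓ} (w : Fin ℓ → ℚ) → sumFin w ≡ 1ℚ → ∀ c → sumFin (λ j → w j * c) ≡ c
  weighted-sum-const w Σw≡1 c =
    trans (sym (*-distribʳ-sumFin c w)) (trans (cong (_* c) Σw≡1) (ℚ.*-identityˡ c))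

  affMap-combo : ∀ {a b ℓ} (A : Fin b → Fin a → ℚ) (c : Pt b) (w : Fin ℓ → ℚ) (p : Fin ℓ → Pt a) →
    sumFin w ≡ 1ℚ → affMap A c (combo w p) ≈ₚ combo w (λ j → affMap A c (p j))
  affMap-combo A c w p Σw≡1 i = begin
    A i · combo w p + c i
      ≡⟨ cong₂ _+_ (dot-combo (A i) w p) (sym (weighted-sum-const w Σw≡1 (c i))) ⟩
    sumFin (λ j → w j * (A i · p j)) + sumFin (λ j → w j * c i)
      ≡⟨ sym (sumFin-distrib-+ (λ j → w j * (A i · p j)) (λ j → w j * c i)) ⟩
    sumFin (λ j → w j * (A i · p j) + w j * c i)
      ≡⟨ sumFin-cong (λ j → sym (ℚ.*-distribˡ-+ (w j) _ (c i))) ⟩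
    sumFin (λ j → w j * (A i · p j + c i)) ∎
    where open ≡-Reasoning

  module _ {n} {V : PtSet n} {α : Pt n} {β : ℚ} where

    hull-of-face⊆face-of-hull : ConvHull (FaceBy V α β) ⊆ FaceBy (ConvHull V) α β
    hull-of-face⊆face-of-hull {y} (ℓ , w , q , w≥0 , Σw≡1 , q∈F , y≈) =
      (ℓ , w , q , w≥0 , Σw≡1 , proj₁ ∘ q∈F , y≈) , (begin
        α · y                          ≡⟨ dot-cong α y≈ ⟩
        α · combo w q                  ≡⟨ dot-combo α w q ⟩
        sumFin (λ j → w j * (α · q j)) ≡⟨ sumFin-cong (cong (w _ *_) ∘ proj₂ ∘ q∈F) ⟩
        sumFin (λ j → w j * β)         ≡⟨ weighted-sum-const w Σw≡1 β ⟩
        β                              ∎)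
      where open ≡-Reasoning

    -- Points of V off the face can only carry weight zero; they are swapped for a point v₀ on it.
    face-of-hull⊆hull-of-face : (∀ v → V v → α · v ≤ β) → ∀ {v₀} → FaceBy V α β v₀ →
                                FaceBy (ConvHull V) α β ⊆ ConvHull (FaceBy V α β)
    face-of-hull⊆hull-of-face valid {v₀} v₀∈F {y} ((ℓ , w , q , w≥0 , Σw≡1 , q∈V , y≈) , αy≡β) =
      ℓ , w , q′ , w≥0 , Σw≡1 , (λ j → pick∈F j (α · q j ℚ.≟ β)) ,
      (λ i → trans (y≈ i) (combo-cong w (λ j i → weight j (α · q j ℚ.≟ β) i) i))
      where
      open ≡-Reasoning
      slack : Fin ℓ → ℚ
      slack j = w j * (α · q j - β)

      Σslack≡0 : sumFin slack ≡ 0ℚ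
      Σslack≡0 = begin
        sumFin (λ j → w j * (α · q j - β))
          ≡⟨ sumFin-cong (λ j → ℚ.*-distribˡ-+ (w j) (α · q j) (- β)) ⟩
        sumFin (λ j → w j * (α · q j) + w j * - β)
          ≡⟨ sumFin-distrib-+ (λ j → w j * (α · q j)) (λ j → w j * - β) ⟩
        sumFin (λ j → w j * (α · q j)) + sumFin (λ j → w j * - β)
          ≡⟨ cong₂ _+_ (sym (dot-combo α w q)) (weighted-sum-const w Σw≡1 (- β)) ⟩
        α · combo w q - β
          ≡⟨ cong (_- β) (trans (sym (dot-cong α y≈)) αy≡β) ⟩
        β - β
          ≡⟨ ℚ.+-inverseʳ β ⟩
        0ℚ ∎

      slack≡0 : ∀ j → slack j ≡ 0ℚ
      slack≡0 = sumFin-nonpos-zero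
        (λ j → nonneg*nonpos≤0 (w≥0 j) (≤⇒-≤0 (valid (q j) (q∈V j)))) Σslack≡0

      pick : ∀ j → Dec (α · q j ≡ β) → Pt n
      pick j (yes _) = q j
      pick j (no _)  = v₀

      q′ : Fin ℓ → Pt n
      q′ j = pick j (α · q j ℚ.≟ β)

      pick∈F : ∀ j d → FaceBy V α β (pick j d)
      pick∈F j (yes αq≡β) = q∈V j , αq≡β
      pick∈F j (no _)     = v₀∈F

      weight : ∀ j d i → w j * q j i ≡ w j * pick j d i
      weight j (yes _) i = refl
      weight j (no αq≢β) i = begin
        w j * q j i ≡⟨ cong (_* q j i) w≡0 ⟩
        0ℚ * q j i  ≡⟨ ℚ.*-zeroˡ (q j i) ⟩
        0ℚ          ≡⟨ sym (ℚ.*-zeroˡ (v₀ i)) ⟩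
        0ℚ * v₀ i   ≡⟨ cong (_* v₀ i) (sym w≡0) ⟩
        w j * v₀ i  ∎
        where
        w≡0 : w j ≡ 0ℚ
        w≡0 = *-zero-cancelʳ (slack≡0 j) (αq≢β ∘ x∙y⁻¹≈ε⇒x≈y (α · q j) β)

  hull-nonneg : ∀ {n} {V : PtSet n} → (∀ v → V v → ∀ i → 0ℚ ≤ v i) → ∀ y → ConvHull V y → ∀ i → 0ℚ ≤ y i
  hull-nonneg V≥0 y (ℓ , w , q , w≥0 , _ , q∈V , y≈) i =
    ℚ.≤-trans (sumFin-nonneg (λ j → nonneg*nonneg (w≥0 j) (V≥0 (q j) (q∈V j) i)))
              (ℚ.≤-reflexive (sym (y≈ i)))

  module _ {a b} (A : Fin b → Fin a → ℚ) (c : Pt b) (B : Fin a → Fin b → ℚ) (d : Pt a) where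

    private
      f = affMap A c
      g = affMap B d

    f∘g-combo : ∀ {ℓ} (w : Fin ℓ → ℚ) (p : Fin ℓ → Pt b) → sumFin w ≡ 1ℚ →
                (∀ j → f (g (p j)) ≈ₚ p j) → f (g (combo w p)) ≈ₚ combo w p
    f∘g-combo w p Σw≡1 fg≈ i = begin
      f (g (combo w p)) i                    ≡⟨ affMap-cong A c (affMap-combo B d w p Σw≡1) i ⟩
      f (combo w (λ j → g (p j))) i          ≡⟨ affMap-combo A c w (λ j → g (p j)) Σw≡1 i ⟩
      combo w (λ j → f (g (p j))) i          ≡⟨ combo-cong w (λ j i → cong (w j *_) (fg≈ j i)) i ⟩
      combo w p i                            ∎
      where open ≡-Reasoning

    affEquiv-from-points : ∀ {X : PtSet a} {Y F : PtSet b} →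
      (∀ x → g (f x) ≈ₚ x) →
      (∀ x → X x → Y (f x)) →
      (∀ y → Y y → X (g y) × f (g y) ≈ₚ y) →
      F ≐ ConvHull Y →
      AffEquiv (ConvHull X) F
    affEquiv-from-points {X} {Y} {F} g∘f≈id f[X]⊆Y g[Y]⊆X (F⊆hull , hull⊆F) =
      A , c , B , d , f[hull]⊆F , F⊆f[hull] , (λ x _ → g∘f≈id x) , f∘g-on-aff
      where
      f∘g-on-hull : ∀ y → ConvHull Y y → f (g y) ≈ₚ y
      f∘g-on-hull y (ℓ , w , q , _ , Σw≡1 , q∈Y , y≈) i = begin
        f (g y) i          ≡⟨ affMap-cong A c (affMap-cong B d y≈) i ⟩
        f (g (combo w q)) i ≡⟨ f∘g-combo w q Σw≡1 (λ j → proj₂ (g[Y]⊆X (q j) (q∈Y j))) i ⟩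
        combo w q i        ≡⟨ sym (y≈ i) ⟩
        y i                ∎
        where open ≡-Reasoning

      f[hull]⊆F : ∀ x → ConvHull X x → F (f x)
      f[hull]⊆F x (ℓ , w , p , w≥0 , Σw≡1 , p∈X , x≈) = hull⊆F
        (ℓ , w , f ∘ p , w≥0 , Σw≡1 , (λ j → f[X]⊆Y (p j) (p∈X j)) ,
         (λ i → trans (affMap-cong A c x≈ i) (affMap-combo A c w p Σw≡1 i)))

      F⊆f[hull] : ∀ y → F y → Σ (Pt a) λ x → ConvHull X x × f x ≈ₚ y
      F⊆f[hull] y y∈F with F⊆hull y∈F
      ... | ℓ , w , q , w≥0 , Σw≡1 , q∈Y , y≈ =
        combo w (g ∘ q) ,
        (ℓ , w , g ∘ q , w≥0 , Σw≡1 , (λ j → proj₁ (g[Y]⊆X (q j) (q∈Y j))) , (λ _ → refl)) ,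
        (λ i → trans (affMap-combo A c w (g ∘ q) Σw≡1 i)
               (trans (combo-cong w (λ j i → cong (w j *_) (proj₂ (g[Y]⊆X (q j) (q∈Y j)) i)) i)
                      (sym (y≈ i))))

      f∘g-on-aff : ∀ y → AffHull F y → f (g y) ≈ₚ y
      f∘g-on-aff y (ℓ , w , q , Σw≡1 , q∈F , y≈) i = begin
        f (g y) i           ≡⟨ affMap-cong A c (affMap-cong B d y≈) i ⟩
        f (g (combo w q)) i ≡⟨ f∘g-combo w q Σw≡1 (λ j → f∘g-on-hull (q j) (F⊆hull (q∈F j))) i ⟩
        combo w q i         ≡⟨ sym (y≈ i) ⟩
        y i                 ∎
        where open ≡-Reasoning

  -- Vertices of the assignment polytope

  Triple : ℕ → Set
  Triple m = Fin m × Fin m × Fin m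

  triple : ∀ {m} → Fin (m ℕ.* m ℕ.* m) → Triple m
  triple {m} i = unnest (remQuot {m ℕ.* m} m i)
    where
    unnest : Fin (m ℕ.* m) × Fin m → Triple m
    unnest (st , u) = proj₁ (remQuot {m} m st) , proj₂ (remQuot {m} m st) , u

  triple-idx3 : ∀ {m} (s t u : Fin m) → triple (idx3 s t u) ≡ (s , t , u)
  triple-idx3 {m} s t u =
    trans (cong (λ (st , u) → proj₁ (remQuot {m} m st) , proj₂ (remQuot {m} m st) , u)
                (remQuot-combine {m ℕ.* m} {m} (combine s t) u))
          (cong (λ (s , t) → s , t , u) (remQuot-combine {m} {m} s t))

  ∀-idx3 : ∀ {m} {P : Fin (m ℕ.* m ℕ.* m) → Set} → (∀ s t u → P (idx3 s t u)) → ∀ i → P i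
  ∀-idx3 {m} {P} P-idx3 i = subst P idx3-triple (P-idx3 (proj₁ t) (proj₁ (proj₂ t)) (proj₂ (proj₂ t)))
    where
    t = triple {m} i
    idx3-triple : idx3 (proj₁ t) (proj₁ (proj₂ t)) (proj₂ (proj₂ t)) ≡ i
    idx3-triple = trans (cong (λ st → combine st (proj₂ (remQuot {m ℕ.* m} m i)))
                              (combine-remQuot {m} m (proj₁ (remQuot {m ℕ.* m} m i))))
                        (combine-remQuot {m ℕ.* m} m i)

  δ-permute : ∀ {m} (π : Permutation′ m) s t → δ (π ⟨$⟩ʳ s) t ≡ δ (π ⟨$⟩ˡ t) s
  δ-permute π s t = 𝟙-cong (λ πs≡t → trans (cong (π ⟨$⟩ˡ_) (sym πs≡t)) (inverseˡ π))
                           (λ π⁻¹t≡s → trans (cong (π ⟨$⟩ʳ_) (sym π⁻¹t≡s)) (inverseʳ π))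
                           (π ⟨$⟩ʳ s ≟ t) (π ⟨$⟩ˡ t ≟ s)

  sumFin-δ-image : ∀ {m} (π : Permutation′ m) t → sumFin (λ s → δ (π ⟨$⟩ʳ s) t) ≡ 1ℚ
  sumFin-δ-image π t = trans (sumFin-cong (λ s → δ-permute π s t)) (sumFin-δ-one (π ⟨$⟩ˡ t))

  sumFin-*δ : ∀ {m} x (b : Fin m) → sumFin (λ u → x * δ b u) ≡ x
  sumFin-*δ x b = trans (sym (*-distribˡ-sumFin x (δ b)))
                        (trans (cong (x *_) (sumFin-δ-one b)) (ℚ.*-identityʳ x))

  *-01 : ∀ {a b} → a ≡ 0ℚ ⊎ a ≡ 1ℚ → b ≡ 0ℚ ⊎ b ≡ 1ℚ → a * b ≡ 0ℚ ⊎ a * b ≡ 1ℚ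
  *-01 {b = b} (inj₁ refl) _ = inj₁ (ℚ.*-zeroˡ b)
  *-01 (inj₂ refl) (inj₁ refl) = inj₁ refl
  *-01 (inj₂ refl) (inj₂ refl) = inj₂ refl

  permutation-vertex : ∀ {m} (σ τ : Permutation′ m) (x : Pt (m ℕ.* m ℕ.* m)) →
    (∀ s t u → x (idx3 s t u) ≡ δ (σ ⟨$⟩ʳ s) t * δ (τ ⟨$⟩ʳ s) u) → TAPVert m x
  permutation-vertex {m} σ τ x x≡ =
    ∀-idx3 {m} (λ s t u → subst (λ z → z ≡ 0ℚ ⊎ z ≡ 1ℚ) (sym (x≡ s t u))
                            (*-01 (𝟙-01 (σ ⟨$⟩ʳ s ≟ t)) (𝟙-01 (τ ⟨$⟩ʳ s ≟ u)))) ,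
    (λ u → begin
      sumFin {m} (λ s → sumFin {m} (λ t → x (idx3 s t u)))
        ≡⟨ sumFin-cong (λ s → trans (sumFin-cong (λ t → trans (x≡ s t u) (ℚ.*-comm _ (δ (τ ⟨$⟩ʳ s) u))))
                                    (sumFin-*δ (δ (τ ⟨$⟩ʳ s) u) (σ ⟨$⟩ʳ s))) ⟩
      sumFin (λ s → δ (τ ⟨$⟩ʳ s) u)
        ≡⟨ sumFin-δ-image τ u ⟩
      1ℚ ∎) ,
    (λ t → begin
      sumFin {m} (λ s → sumFin {m} (λ u → x (idx3 s t u)))
        ≡⟨ sumFin-cong (λ s → trans (sumFin-cong (x≡ s t)) (sumFin-*δ (δ (σ ⟨$⟩ʳ s) t) (τ ⟨$⟩ʳ s))) ⟩
      sumFin (λ s → δ (σ ⟨$⟩ʳ s) t)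
        ≡⟨ sumFin-δ-image σ t ⟩
      1ℚ ∎) ,
    (λ s → begin
      sumFin {m} (λ t → sumFin {m} (λ u → x (idx3 s t u)))
        ≡⟨ sumFin-cong (λ t → trans (sumFin-cong (x≡ s t)) (sumFin-*δ (δ (σ ⟨$⟩ʳ s) t) (τ ⟨$⟩ʳ s))) ⟩
      sumFin (δ (σ ⟨$⟩ʳ s))
        ≡⟨ sumFin-δ-one (σ ⟨$⟩ʳ s) ⟩
      1ℚ ∎)
    where open ≡-Reasoning

  sumList : List ℚ → ℚ
  sumList = foldr _+_ 0ℚ

  second-of-pair : ∀ a b → sumList (a ∷ b ∷ []) ≡ 1ℚ → b ≡ 1ℚ - a
  second-of-pair a b a+b≡1 = trans (rearrange a b) (cong (_- a) a+b≡1)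
    where
    open +-*-Solver
    rearrange : ∀ a b → b ≡ a + (b + 0ℚ) - a
    rearrange = solve 2 (λ a b → b := a :+ (b :+ con 0ℚ) :- a) refl

  partners-agree : ∀ a b c → sumList (a ∷ b ∷ []) ≡ 1ℚ → sumList (b ∷ c ∷ []) ≡ 1ℚ → c ≡ a
  partners-agree a b c a+b≡1 b+c≡1 = begin
    c             ≡⟨ second-of-pair b c b+c≡1 ⟩
    1ℚ - b        ≡⟨ cong (λ y → 1ℚ - y) (second-of-pair a b a+b≡1) ⟩
    1ℚ - (1ℚ - a) ≡⟨ double-complement a ⟩
    a             ∎
    where
    open ≡-Reasoning
    open +-*-Solver
    double-complement : ∀ a → 1ℚ - (1ℚ - a) ≡ a
    double-complement = solve 1 (λ a → con 1ℚ :- (con 1ℚ :- a) := a) refl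

  third-of-triple : ∀ a b c → sumList (a ∷ b ∷ c ∷ []) ≡ 1ℚ → c ≡ 1ℚ - a - b
  third-of-triple a b c a+b+c≡1 = trans (rearrange a b c) (cong (λ s → s - a - b) a+b+c≡1)
    where
    open +-*-Solver
    rearrange : ∀ a b c → c ≡ a + (b + (c + 0ℚ)) - a - b
    rearrange = solve 3 (λ a b c → c := a :+ (b :+ (c :+ con 0ℚ)) :- a :- b) refl

  complement≤1 : ∀ a b c → 0ℚ ≤ c → c ≡ 1ℚ - a - b → a + b ≤ 1ℚ
  complement≤1 a b c 0≤c c≡ = begin
    a + b             ≡⟨ double-complement a b ⟩
    1ℚ - (1ℚ - a - b) ≡⟨ cong (λ y → 1ℚ - y) (sym c≡) ⟩
    1ℚ - c            ≤⟨ ℚ.+-monoʳ-≤ 1ℚ (ℚ.neg-antimono-≤ 0≤c) ⟩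
    1ℚ - 0ℚ           ≡⟨ ℚ.+-identityʳ 1ℚ ⟩
    1ℚ                ∎
    where
    open ℚ.≤-Reasoning
    open +-*-Solver
    double-complement : ∀ a b → a + b ≡ 1ℚ - (1ℚ - a - b)
    double-complement = solve 2 (λ a b → a :+ b := con 1ℚ :- (con 1ℚ :- a :- b)) refl

  _≟²_ : ∀ {M} → DecidableEquality (Fin M × Fin M)
  _≟²_ = ×-≡-dec _≟_ _≟_

  𝟙-≟² : ∀ {M} (a b s u : Fin M) → 𝟙 ((a , b) ≟² (s , u)) ≡ δ a s * δ b u
  𝟙-≟² a b s u = trans (𝟙-cong ,-injective (uncurry (cong₂ _,_)) ((a , b) ≟² (s , u))
                                ((a ≟ s) ×-dec (b ≟ u)))
                       (𝟙-× (a ≟ s) (b ≟ u))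

  sumFin²-δ : ∀ {M} (a b : Fin M) c →
              sumFin (λ s → sumFin (λ u → 𝟙 ((a , b) ≟² (s , u)) * c)) ≡ c
  sumFin²-δ a b c = begin
    sumFin (λ s → sumFin (λ u → 𝟙 ((a , b) ≟² (s , u)) * c))
      ≡⟨ sumFin-cong (λ s → sumFin-cong (λ u → trans (cong (_* c) (𝟙-≟² a b s u))
                                                  (ℚ.*-assoc (δ a s) (δ b u) c))) ⟩
    sumFin (λ s → sumFin (λ u → δ a s * (δ b u * c)))
      ≡⟨ sumFin-cong (λ s → sym (*-distribˡ-sumFin (δ a s) (λ u → δ b u * c))) ⟩
    sumFin (λ s → δ a s * sumFin (λ u → δ b u * c))
      ≡⟨ sumFin-δ a (λ _ → sumFin (λ u → δ b u * c)) ⟩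
    sumFin (λ u → δ b u * c)
      ≡⟨ sumFin-δ b (λ _ → c) ⟩
    c ∎
    where open ≡-Reasoning

  sumFin²-support : ∀ {M} (H : Fin M → Fin M → ℚ) (ps : List (Fin M × Fin M)) → Unique ps →
    (∀ s u → H s u ≡ 0ℚ ⊎ (s , u) ∈ ps) →
    sumFin (λ s → sumFin (λ u → H s u)) ≡ sumList (map (uncurry H) ps)
  sumFin²-support H [] _ H⊆ps = sumFin-zero (λ s → sumFin-zero (λ u → H≡0 s u (H⊆ps s u)))
    where
    H≡0 : ∀ s u → H s u ≡ 0ℚ ⊎ (s , u) ∈ [] → H s u ≡ 0ℚ
    H≡0 s u (inj₁ H≡0) = H≡0
  sumFin²-support {M} H ((a , b) ∷ ps) (ab∉ps ∷ ps!) H⊆ps = begin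
    sumFin (λ s → sumFin (λ u → H s u))
      ≡⟨ sumFin-cong (λ s → trans (sumFin-cong (split s))
                                  (sumFin-distrib-+ (λ u → atAB s u) (λ u → H′ s u))) ⟩
    sumFin (λ s → sumFin (λ u → atAB s u) + sumFin (λ u → H′ s u))
      ≡⟨ sumFin-distrib-+ (λ s → sumFin (λ u → atAB s u)) (λ s → sumFin (λ u → H′ s u)) ⟩
    sumFin (λ s → sumFin (λ u → atAB s u)) + sumFin (λ s → sumFin (λ u → H′ s u))
      ≡⟨ cong₂ _+_ (sumFin²-δ a b (H a b)) (sumFin²-support H′ ps ps! H′⊆ps) ⟩
    H a b + sumList (map (uncurry H′) ps)
      ≡⟨ cong (H a b +_) (sumList-map-cong H′=H) ⟩
    H a b + sumList (map (uncurry H) ps) ∎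
    where
    open ≡-Reasoning
    atAB H′ : Fin M → Fin M → ℚ
    atAB s u = 𝟙 ((a , b) ≟² (s , u)) * H a b
    H′ s u = 𝟙 (¬? ((a , b) ≟² (s , u))) * H s u

    split : ∀ s u → H s u ≡ atAB s u + H′ s u
    split s u with (a , b) ≟² (s , u)
    ... | yes refl = sym (trans (cong₂ _+_ (ℚ.*-identityˡ (H a b)) (ℚ.*-zeroˡ (H a b)))
                                (ℚ.+-identityʳ (H a b)))
    ... | no _     = sym (trans (cong₂ _+_ (ℚ.*-zeroˡ (H a b)) (ℚ.*-identityˡ (H s u)))
                                (ℚ.+-identityˡ (H s u)))

    H′⊆ps : ∀ s u → H′ s u ≡ 0ℚ ⊎ (s , u) ∈ ps
    H′⊆ps s u with (a , b) ≟² (s , u) | H⊆ps s u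
    ... | yes _ | _                = inj₁ (ℚ.*-zeroˡ (H s u))
    ... | no _  | inj₁ H≡0         = inj₁ (trans (ℚ.*-identityˡ (H s u)) H≡0)
    ... | no ab≢su | inj₂ (here su≡ab) = ⊥-elim (ab≢su (sym su≡ab))
    ... | no _  | inj₂ (there su∈ps) = inj₂ su∈ps

    H′=H : All (λ (s , u) → H′ s u ≡ H s u) ps
    H′=H = All.map (λ {(s , u)} ab≢su → trans (cong (_* H s u) (𝟙-yes (¬? ((a , b) ≟² (s , u))) ab≢su))
                                              (ℚ.*-identityˡ (H s u))) ab∉ps

    sumList-map-cong : ∀ {qs} → All (λ (s , u) → H′ s u ≡ H s u) qs →
                       sumList (map (uncurry H′) qs) ≡ sumList (map (uncurry H) qs)
    sumList-map-cong []         = refl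
    sumList-map-cong (e ∷ eqs) = cong₂ _+_ e (sumList-map-cong eqs)

  module _ {K V : Set} (_≟ₖ_ : DecidableEquality K) (default : V) where

    find : List (K × V) → K → V
    find []             k = default
    find ((k′ , v) ∷ l) k = if does (k ≟ₖ k′) then v else find l k

    keys : List (K × V) → List K
    keys = map proj₁

    find-here : ∀ k v l → find ((k , v) ∷ l) k ≡ v
    find-here k v l with k ≟ₖ k
    ... | yes _  = refl
    ... | no k≢k = ⊥-elim (k≢k refl)

    find-default-or-key : ∀ l k → find l k ≡ default ⊎ k ∈ keys l
    find-default-or-key []             k = inj₁ refl
    find-default-or-key ((k′ , v) ∷ l) k with k ≟ₖ k′
    ... | yes k≡k′ = inj₂ (here k≡k′)
    ... | no _     = Sum.map₂ there (find-default-or-key l k)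

    find-spec : (F : V → ℚ) (h : K → ℚ) → ∀ l → All (λ (k , v) → h k ≡ F v) l →
                ∀ k → (k ∉ keys l → h k ≡ F default) → h k ≡ F (find l k)
    find-spec F h []             []            k off = off (λ ())
    find-spec F h ((k′ , v) ∷ l) (hk′ ∷ spec) k off with k ≟ₖ k′
    ... | yes refl = hk′
    ... | no k≢k′  = find-spec F h l spec k (λ k∉l → off λ { (here k≡k′) → k≢k′ k≡k′
                                                            ; (there k∈l) → k∉l k∈l })

  unique₂ : ∀ {A : Set} {a b : A} → a ≢ b → Unique (a ∷ b ∷ [])
  unique₂ a≢b = (a≢b ∷ []) ∷ [] ∷ []

  lookup-injective : ∀ {A : Set} {xs : List A} → Unique xs →
                     ∀ {i j} → lookup xs i ≡ lookup xs j → i ≡ j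
  lookup-injective {xs = _ ∷ _}  (_ ∷ _)    {zero}  {zero}  _  = refl
  lookup-injective {xs = _ ∷ _} (x∉xs ∷ _) {zero}  {suc j} x≡ = ⊥-elim (All.lookup x∉xs (∈-lookup j) x≡)
  lookup-injective {xs = _ ∷ _} (x∉xs ∷ _) {suc i} {zero}  ≡x = ⊥-elim (All.lookup x∉xs (∈-lookup i) (sym ≡x))
  lookup-injective {xs = _ ∷ _}  (_ ∷ xs!)  {suc i} {suc j} eq = cong suc (lookup-injective xs! eq)

  -- Cyclic order on colour classes

  data Least {N} (P : Fin N → Set) : Set where
    none  : (∀ i → ¬ P i) → Least P
    least : ∀ j → P j → (∀ i → i Fin.< j → ¬ P i) → Least P

  data Greatest {N} (P : Fin N → Set) : Set where
    none     : (∀ i → ¬ P i) → Greatest P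
    greatest : ∀ j → P j → (∀ i → j Fin.< i → ¬ P i) → Greatest P

  findLeast : ∀ {N} {P : Fin N → Set} → Decidable P → Least P
  findLeast {ℕ.zero}  P? = none (λ ())
  findLeast {ℕ.suc N} P? with P? zero | findLeast (P? ∘ suc)
  ... | yes p₀ | _            = least zero p₀ (λ _ ())
  ... | no ¬p₀ | none ¬p      = none λ { zero → ¬p₀ ; (suc i) → ¬p i }
  ... | no ¬p₀ | least j p ¬q = least (suc j) p λ { zero _ → ¬p₀ ; (suc i) (ℕ.s≤s i<j) → ¬q i i<j }

  findGreatest : ∀ {N} {P : Fin N → Set} → Decidable P → Greatest P
  findGreatest {ℕ.zero}  P? = none (λ ())
  findGreatest {ℕ.suc N} P? with findGreatest (P? ∘ suc) | P? zero
  ... | greatest j p ¬q | _      = greatest (suc j) p λ { zero () ; (suc i) (ℕ.s≤s j<i) → ¬q i j<i }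
  ... | none ¬p         | yes p₀ = greatest zero p₀ λ { zero () ; (suc i) _ → ¬p i }
  ... | none ¬p         | no ¬p₀ = none λ { zero → ¬p₀ ; (suc i) → ¬p i }

  -- Each colour class, in increasing order, is closed up into a cycle.
  module CyclicOrder {N} {C : Set} (_≟c_ : DecidableEquality C) (colour : Fin N → C) where

    open WF.All (<-wellFounded {N}) Level.zero using (wfRec)

    IsNext : Fin N → Fin N → Set
    IsNext j i = colour i ≡ colour j ×
      ((j < i × (∀ z → j < z → z < i → colour z ≢ colour j)) ⊎
       ((∀ z → j < z → colour z ≢ colour j) × (∀ z → z < i → colour z ≢ colour j)))

    private
      After Before SameColour : Fin N → Fin N → Set
      After j i      = j < i × colour i ≡ colour j
      Before j i     = i < j × colour i ≡ colour j
      SameColour j i = colour i ≡ colour j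

      nextOf : ∀ j → Least (After j) → Least (SameColour j) → Fin N
      nextOf j (least i _ _) _          = i
      nextOf j (none _)      (least i _ _) = i
      nextOf j (none _)      (none _)      = j

      prevOf : ∀ j → Greatest (Before j) → Greatest (SameColour j) → Fin N
      prevOf j (greatest i _ _) _               = i
      prevOf j (none _)         (greatest i _ _) = i
      prevOf j (none _)         (none _)         = j

      nextOf-IsNext : ∀ j a s → IsNext j (nextOf j a s)
      nextOf-IsNext j (least i (j<i , ci) ¬b) _ = ci , inj₁ (j<i , λ z j<z z<i cz → ¬b z z<i (j<z , cz))
      nextOf-IsNext j (none ¬a) (least i ci ¬b) =
        ci , inj₂ ((λ z j<z cz → ¬a z (j<z , cz)) , (λ z z<i cz → ¬b z z<i cz))
      nextOf-IsNext j (none _) (none ¬s) = ⊥-elim (¬s j refl)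

      prevOf-IsNext : ∀ j b s → IsNext (prevOf j b s) j
      prevOf-IsNext j (greatest i (i<j , ci) ¬a) _ =
        sym ci , inj₁ (i<j , λ z i<z z<j cz → ¬a z i<z (z<j , trans cz ci))
      prevOf-IsNext j (none ¬b) (greatest i ci ¬a) =
        sym ci , inj₂ ((λ z i<z cz → ¬a z i<z (trans cz ci)) , (λ z z<j cz → ¬b z (z<j , trans cz ci)))
      prevOf-IsNext j (none _) (none ¬s) = ⊥-elim (¬s j refl)

      after? : ∀ j → Decidable (After j)
      after? j i = (j Fin.<? i) ×-dec (colour i ≟c colour j)

      before? : ∀ j → Decidable (Before j)
      before? j i = (i Fin.<? j) ×-dec (colour i ≟c colour j)

      sameColour? : ∀ j → Decidable (SameColour j)
      sameColour? j i = colour i ≟c colour j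

    next prev : Fin N → Fin N
    next j = nextOf j (findLeast (after? j)) (findLeast (sameColour? j))
    prev j = prevOf j (findGreatest (before? j)) (findGreatest (sameColour? j))

    next-IsNext : ∀ j → IsNext j (next j)
    next-IsNext j = nextOf-IsNext j (findLeast (after? j)) (findLeast (sameColour? j))

    prev-IsNext : ∀ j → IsNext (prev j) j
    prev-IsNext j = prevOf-IsNext j (findGreatest (before? j)) (findGreatest (sameColour? j))

    IsNext-functional : ∀ {j i i′} → IsNext j i → IsNext j i′ → i ≡ i′
    IsNext-functional {j} {i} {i′} (ci , next₁) (ci′ , next₂) with <-cmp i i′ | next₁ | next₂
    ... | tri≈ _ i≡i′ _ | _ | _ = i≡i′
    ... | tri< i<i′ _ _ | inj₁ (j<i , _) | inj₁ (_ , between) = ⊥-elim (between i j<i i<i′ ci)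
    ... | tri< i<i′ _ _ | inj₂ (_ , _)   | inj₂ (_ , before)  = ⊥-elim (before i i<i′ ci)
    ... | tri> _ _ i′<i | inj₁ (_ , between) | inj₁ (j<i′ , _) = ⊥-elim (between i′ j<i′ i′<i ci′)
    ... | tri> _ _ i′<i | inj₂ (_ , before)  | inj₂ (_ , _)    = ⊥-elim (before i′ i′<i ci′)
    ... | _ | inj₁ (j<i , _) | inj₂ (after , _) = ⊥-elim (after i j<i ci)
    ... | _ | inj₂ (after , _) | inj₁ (j<i′ , _) = ⊥-elim (after i′ j<i′ ci′)

    IsNext-injective : ∀ {j j′ i} → IsNext j i → IsNext j′ i → j ≡ j′
    IsNext-injective {j} {j′} (ci , next₁) (ci′ , next₂) with trans (sym ci′) ci | <-cmp j j′ | next₁ | next₂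
    ... | _    | tri≈ _ j≡j′ _ | _ | _ = j≡j′
    ... | c′≡c | tri< j<j′ _ _ | inj₁ (_ , between) | inj₁ (j′<i , _)  = ⊥-elim (between j′ j<j′ j′<i c′≡c)
    ... | c′≡c | tri< j<j′ _ _ | inj₂ (after , _)   | inj₂ _            = ⊥-elim (after j′ j<j′ c′≡c)
    ... | c′≡c | tri> _ _ j′<j | inj₁ (j<i , _)     | inj₁ (_ , between) = ⊥-elim (between j j′<j j<i (sym c′≡c))
    ... | c′≡c | tri> _ _ j′<j | inj₂ _             | inj₂ (after , _)  = ⊥-elim (after j j′<j (sym c′≡c))
    ... | c′≡c | _ | inj₁ (j<i , _)    | inj₂ (_ , before) = ⊥-elim (before j j<i (sym c′≡c))
    ... | c′≡c | _ | inj₂ (_ , before) | inj₁ (j′<i , _)   = ⊥-elim (before j′ j′<i c′≡c)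

    colour-next : ∀ j → colour (next j) ≡ colour j
    colour-next j = proj₁ (next-IsNext j)

    colour-prev : ∀ j → colour (prev j) ≡ colour j
    colour-prev j = sym (proj₁ (prev-IsNext j))

    prev-next : ∀ j → prev (next j) ≡ j
    prev-next j = IsNext-injective (prev-IsNext (next j)) (next-IsNext j)

    next-prev : ∀ j → next (prev j) ≡ j
    next-prev j = IsNext-functional (next-IsNext (prev j)) (prev-IsNext j)

    -- Going down along prev one reaches the least element of the colour class.
    prev-invariant⇒constant : ∀ {A : Set} (X : Fin N → A) → (∀ j → X (prev j) ≡ X j) →
                              ∀ {i j} → colour i ≡ colour j → X i ≡ X j
    prev-invariant⇒constant X X-prev {i} {j} ci≡cj with findLeast (sameColour? j)
    ... | none ¬s = ⊥-elim (¬s j refl)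
    ... | least j₀ cj₀ ¬s = trans (to-least i ci≡cj) (sym (to-least j refl))
      where
      to-least : ∀ k → colour k ≡ colour j → X k ≡ X j₀
      to-least = wfRec (λ k → colour k ≡ colour j → X k ≡ X j₀) step
        where
        step : ∀ k → WfRec _<_ (λ k → colour k ≡ colour j → X k ≡ X j₀) k →
               colour k ≡ colour j → X k ≡ X j₀
        step k rec ck with prev-IsNext k
        ... | cp , inj₁ (p<k , _) = trans (sym (X-prev k)) (rec p<k (trans (sym cp) ck))
        ... | cp , inj₂ (_ , before) with <-cmp k j₀
        ...   | tri< k<j₀ _ _ = ⊥-elim (¬s k k<j₀ ck)
        ...   | tri≈ _ k≡j₀ _ = cong X k≡j₀
        ...   | tri> _ _ j₀<k = ⊥-elim (before j₀ j₀<k (trans cj₀ (trans (sym ck) cp)))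

  -- Affine forms

  data Form (k : ℕ) : Set where
    zeroᶠ        : Form k
    varᶠ compᶠ   : Fin k → Form k
    comp₂ᶠ       : Fin k → Fin k → Form k

  eval : ∀ {k} → Form k → Pt k → ℚ
  eval zeroᶠ        x = 0ℚ
  eval (varᶠ v)     x = x v
  eval (compᶠ v)    x = 1ℚ - x v
  eval (comp₂ᶠ a b) x = 1ℚ - x a - x b

  coeff : ∀ {k} → Form k → Pt k
  coeff zeroᶠ        j = 0ℚ
  coeff (varᶠ v)     j = δ v j
  coeff (compᶠ v)    j = - δ v j
  coeff (comp₂ᶠ a b) j = - δ a j - δ b j

  const : ∀ {k} → Form k → ℚ
  const zeroᶠ        = 0ℚ
  const (varᶠ _)     = 0ℚ
  const (compᶠ _)    = 1ℚ
  const (comp₂ᶠ _ _) = 1ℚ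

  eval-affine : ∀ {k} (φ : Form k) x → coeff φ · x + const φ ≡ eval φ x
  eval-affine zeroᶠ x = trans (ℚ.+-identityʳ _) (sumFin-zero (λ j → ℚ.*-zeroˡ (x j)))
  eval-affine (varᶠ v) x = trans (ℚ.+-identityʳ _) (sumFin-δ v x)
  eval-affine (compᶠ v) x = begin
    sumFin (λ j → - δ v j * x j) + 1ℚ
      ≡⟨ cong (_+ 1ℚ) (sumFin-cong (λ j → sym (ℚ.neg-distribˡ-* (δ v j) (x j)))) ⟩
    sumFin (λ j → - (δ v j * x j)) + 1ℚ
      ≡⟨ cong (_+ 1ℚ) (sumFin-neg (λ j → δ v j * x j)) ⟩
    - (δ v · x) + 1ℚ
      ≡⟨ cong (λ y → - y + 1ℚ) (sumFin-δ v x) ⟩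
    - x v + 1ℚ
      ≡⟨ ℚ.+-comm (- x v) 1ℚ ⟩
    1ℚ - x v ∎
    where open ≡-Reasoning
  eval-affine (comp₂ᶠ a b) x = begin
    sumFin (λ j → (- δ a j - δ b j) * x j) + 1ℚ
      ≡⟨ cong (_+ 1ℚ) (sumFin-cong (λ j → distrib (δ a j) (δ b j) (x j))) ⟩
    sumFin (λ j → - (δ a j * x j) + - (δ b j * x j)) + 1ℚ
      ≡⟨ cong (_+ 1ℚ) (sumFin-distrib-+ (λ j → - (δ a j * x j)) (λ j → - (δ b j * x j))) ⟩
    sumFin (λ j → - (δ a j * x j)) + sumFin (λ j → - (δ b j * x j)) + 1ℚ
      ≡⟨ cong₂ (λ y z → y + z + 1ℚ) (sumFin-neg (λ j → δ a j * x j)) (sumFin-neg (λ j → δ b j * x j)) ⟩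
    - (δ a · x) + - (δ b · x) + 1ℚ
      ≡⟨ cong₂ (λ y z → - y + - z + 1ℚ) (sumFin-δ a x) (sumFin-δ b x) ⟩
    - x a + - x b + 1ℚ
      ≡⟨ rearrange (x a) (x b) ⟩
    1ℚ - x a - x b ∎
    where
    open ≡-Reasoning
    open +-*-Solver
    distrib : ∀ p q y → (- p - q) * y ≡ - (p * y) + - (q * y)
    distrib = solve 3 (λ p q y → (:- p :- q) :* y := :- (p :* y) :+ :- (q :* y)) refl
    rearrange : ∀ p q → - p + - q + 1ℚ ≡ 1ℚ - p - q
    rearrange = solve 2 (λ p q → :- p :+ :- q :+ con 1ℚ := con 1ℚ :- p :- q) refl

  eval-cong : ∀ {k} (φ : Form k) {x y} → x ≈ₚ y → eval φ x ≡ eval φ y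
  eval-cong zeroᶠ        x≈y = refl
  eval-cong (varᶠ v)     x≈y = x≈y v
  eval-cong (compᶠ v)    x≈y = cong (λ y → 1ℚ - y) (x≈y v)
  eval-cong (comp₂ᶠ a b) x≈y = cong₂ (λ p q → 1ℚ - p - q) (x≈y a) (x≈y b)

  zeroᶠ? : ∀ {k} (φ : Form k) → Dec (φ ≡ zeroᶠ)
  zeroᶠ? zeroᶠ        = yes refl
  zeroᶠ? (varᶠ _)     = no λ ()
  zeroᶠ? (compᶠ _)    = no λ ()
  zeroᶠ? (comp₂ᶠ _ _) = no λ ()

  -- The construction

  module Construction {k} (E : List (Edge k)) where

    n W m : ℕ
    n = length E
    W = numIsolated E
    m = 3 ℕ.* n ℕ.+ 2 ℕ.* W

    Port : Set
    Port = Fin (n ℕ.+ n)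

    endA endB : Fin n → Port
    endA i = i ↑ˡ n
    endB i = n ↑ʳ i

    edgeOf : Port → Fin n
    edgeOf j = [ id , id ]′ (splitAt n j)

    colour : Port → Fin k
    colour j = [ proj₁ ∘ lookup E , proj₂ ∘ lookup E ]′ (splitAt n j)

    edgeOf-endA : ∀ i → edgeOf (endA i) ≡ i
    edgeOf-endA i rewrite splitAt-↑ˡ n i n = refl

    edgeOf-endB : ∀ i → edgeOf (endB i) ≡ i
    edgeOf-endB i rewrite splitAt-↑ʳ n n i = refl

    colour-endA : ∀ i → colour (endA i) ≡ proj₁ (lookup E i)
    colour-endA i rewrite splitAt-↑ˡ n i n = refl

    colour-endB : ∀ i → colour (endB i) ≡ proj₂ (lookup E i)
    colour-endB i rewrite splitAt-↑ʳ n n i = refl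

    endA≢endB : ∀ i i′ → endA i ≢ endB i′
    endA≢endB i i′ eq with trans (sym (splitAt-↑ˡ n i n)) (trans (cong (splitAt n) eq)
                                                                (splitAt-↑ʳ n n i′))
    ... | ()

    endA-or-endB : ∀ j → j ≡ endA (edgeOf j) ⊎ j ≡ endB (edgeOf j)
    endA-or-endB j with splitAt n j in eq
    ... | inj₁ i = inj₁ (sym (splitAt⁻¹-↑ˡ eq))
    ... | inj₂ i = inj₂ (sym (splitAt⁻¹-↑ʳ eq))

    open CyclicOrder _≟_ colour public using (next; prev; colour-next; colour-prev; prev-next; next-prev;
                                              prev-invariant⇒constant)

    IsolatedVertex : Fin k → Set
    IsolatedVertex v = ¬ Any (λ e → proj₁ e ≡ v ⊎ proj₂ e ≡ v) E

    isolated? : Decidable IsolatedVertex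
    isolated? v = ¬? (any? (λ e → (proj₁ e ≟ v) ⊎-dec (proj₂ e ≟ v)) E)

    isolatedVertices : List (Fin k)
    isolatedVertices = filter isolated? (allFin k)

    iso : Fin W → Fin k
    iso = lookup isolatedVertices

    iso-isolated : ∀ w → IsolatedVertex (iso w)
    iso-isolated w = proj₂ (∈-filter⁻ isolated? {xs = allFin k} (∈-lookup {xs = isolatedVertices} w))

    isoIndex : ∀ v → IsolatedVertex v → Fin W
    isoIndex v v-iso = index (∈-filter⁺ isolated? (∈-allFin v) v-iso)

    iso-isoIndex : ∀ v v-iso → iso (isoIndex v v-iso) ≡ v
    iso-isoIndex v v-iso = sym (lookup-index (∈-filter⁺ isolated? (∈-allFin v) v-iso))

    isoIndex-iso : ∀ w w-iso → isoIndex (iso w) w-iso ≡ w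
    isoIndex-iso w w-iso = lookup-injective (Unique.filter⁺ isolated? (Unique.allFin⁺ k))
                                            (iso-isoIndex (iso w) w-iso)

    Any-lookup : ∀ {P : Edge k → Set} i → P (lookup E i) → Any P E
    Any-lookup i p = Any.map (λ eq → subst _ eq p) (∈-lookup {xs = E} i)

    isolated⇒no-port : ∀ v → IsolatedVertex v → ∀ j → colour j ≢ v
    isolated⇒no-port v v-iso j cj≡v with endA-or-endB j
    ... | inj₁ j≡A = v-iso (Any-lookup (edgeOf j)
                              (inj₁ (trans (sym (colour-endA _)) (trans (cong colour (sym j≡A)) cj≡v))))
    ... | inj₂ j≡B = v-iso (Any-lookup (edgeOf j)
                              (inj₂ (trans (sym (colour-endB _)) (trans (cong colour (sym j≡B)) cj≡v))))

    no-port⇒isolated : ∀ v → (∀ j → colour j ≢ v) → IsolatedVertex v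
    no-port⇒isolated v no-port e∈E with index e∈E | lookup-index e∈E
    ... | i | inj₁ a≡v = no-port (endA i) (trans (colour-endA i) a≡v)
    ... | i | inj₂ b≡v = no-port (endB i) (trans (colour-endB i) b≡v)

    El : Set
    El = Port ⊎ Fin n ⊎ Fin W ⊎ Fin W

    pattern port j = inj₁ j
    pattern edge i = inj₂ (inj₁ i)
    pattern isoA w = inj₂ (inj₂ (inj₁ w))
    pattern isoB w = inj₂ (inj₂ (inj₂ w))

    port-endA≢port-endB : ∀ i → _≢_ {A = El} (port (endA i)) (port (endB i))
    port-endA≢port-endB i eq = endA≢endB i i (inj₁-injective eq)

    -- Opaque, so that the keys in 𝟙 (k ≟ₑ² K) can be inferred by unification.
    opaque
      _≟ₑ²_ : DecidableEquality (El × El)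
      _≟ₑ²_ = ×-≡-dec _≟ₑ_ _≟ₑ_
        where
        _≟ₑ_ : DecidableEquality El
        _≟ₑ_ = ⊎-≡-dec _≟_ (⊎-≡-dec _≟_ (⊎-≡-dec _≟_ _≟_))

    m≡ : m ≡ (n ℕ.+ n) ℕ.+ (n ℕ.+ (W ℕ.+ W))
    m≡ = begin
      n ℕ.+ (n ℕ.+ (n ℕ.+ 0)) ℕ.+ (W ℕ.+ (W ℕ.+ 0)) ≡⟨ cong₂ (λ a b → n ℕ.+ (n ℕ.+ a) ℕ.+ (W ℕ.+ b))
                                                        (ℕ.+-identityʳ n) (ℕ.+-identityʳ W) ⟩
      n ℕ.+ (n ℕ.+ n) ℕ.+ (W ℕ.+ W)                 ≡⟨ cong (ℕ._+ (W ℕ.+ W)) (sym (ℕ.+-assoc n n n)) ⟩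
      n ℕ.+ n ℕ.+ n ℕ.+ (W ℕ.+ W)                   ≡⟨ ℕ.+-assoc (n ℕ.+ n) n (W ℕ.+ W) ⟩
      n ℕ.+ n ℕ.+ (n ℕ.+ (W ℕ.+ W))                 ∎
      where open ≡-Reasoning

    encoding : Fin m ↔ El
    encoding = ↔-trans (subst (λ M → Fin m ↔ Fin M) m≡ ↔-refl)
               (↔-trans +↔⊎ (↔-refl ⊎-↔ (↔-trans +↔⊎ (↔-refl ⊎-↔ +↔⊎))))

    dec : Fin m → El
    dec = Inverse.to encoding

    enc : El → Fin m
    enc = Inverse.from encoding

    dec-enc : ∀ S → dec (enc S) ≡ S
    dec-enc = Inverse.strictlyInverseˡ encoding

    enc-dec : ∀ s → enc (dec s) ≡ s
    enc-dec = Inverse.strictlyInverseʳ encoding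

    enc-injective : ∀ {S T} → enc S ≡ enc T → S ≡ T
    enc-injective {S} {T} eq = trans (sym (dec-enc S)) (trans (cong dec eq) (dec-enc T))

    conjugate : El ↔ El → Permutation′ m
    conjugate π = ↔-trans encoding (↔-trans π (↔-sym encoding))

    -- entries S lists the (t , u) with x(S,t,u) not identically 0, and the form of that coordinate.
    entries : El → List ((El × El) × Form k)
    entries (port j) = ((port (next j) , edge (edgeOf j)) , varᶠ (colour j))
                     ∷ ((port j , port j) , compᶠ (colour j)) ∷ []
    entries (edge i) = ((edge i , port (endA i)) , varᶠ (colour (endA i)))
                     ∷ ((edge i , port (endB i)) , varᶠ (colour (endB i)))
                     ∷ ((edge i , edge i) , comp₂ᶠ (colour (endA i)) (colour (endB i))) ∷ []
    entries (isoA w) = ((isoA w , isoB w) , varᶠ (iso w)) ∷ ((isoA w , isoA w) , compᶠ (iso w)) ∷ []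
    entries (isoB w) = ((isoB w , isoA w) , varᶠ (iso w)) ∷ ((isoB w , isoB w) , compᶠ (iso w)) ∷ []

    form : El → El → El → Form k
    form S T U = find _≟ₑ²_ zeroᶠ (entries S) (T , U)

    support : El → List (El × El)
    support S = keys _≟ₑ²_ zeroᶠ (entries S)

    form-zero-or-support : ∀ S T U → form S T U ≡ zeroᶠ ⊎ (T , U) ∈ support S
    form-zero-or-support S T U = find-default-or-key _≟ₑ²_ zeroᶠ (entries S) (T , U)

    support-unique : ∀ S → Unique (support S)
    support-unique (port j) = unique₂ λ ()
    support-unique (edge i) = ((port-endA≢port-endB i ∘ ,-injectiveʳ) ∷ (λ ()) ∷ []) ∷ ((λ ()) ∷ []) ∷ [] ∷ []
    support-unique (isoA w) = unique₂ λ ()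
    support-unique (isoB w) = unique₂ λ ()

    formAt : Fin (m ℕ.* m ℕ.* m) → Form k
    formAt i = let s , t , u = triple {m} i in form (dec s) (dec t) (dec u)

    formAt-idx3 : ∀ s t u → formAt (idx3 s t u) ≡ form (dec s) (dec t) (dec u)
    formAt-idx3 s t u = cong (λ (s , t , u) → form (dec s) (dec t) (dec u)) (triple-idx3 s t u)

    formAt-enc : ∀ S T U → formAt (idx3 (enc S) (enc T) (enc U)) ≡ form S T U
    formAt-enc S T U = trans (formAt-idx3 (enc S) (enc T) (enc U))
                             (cong₃ form (dec-enc S) (dec-enc T) (dec-enc U))

    embed : Pt k → Pt (m ℕ.* m ℕ.* m)
    embed = affMap (coeff ∘ formAt) (const ∘ formAt)

    embed-eval : ∀ x i → embed x i ≡ eval (formAt i) x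
    embed-eval x i = eval-affine (formAt i) x

    -- A coordinate reading off x v: at the first port of colour v, or at v itself if v is isolated.
    readout : ∀ v → Least (λ j → colour j ≡ v) → Fin (m ℕ.* m ℕ.* m)
    readout v (least j _ _) = idx3 (enc (port j)) (enc (port (next j))) (enc (edge (edgeOf j)))
    readout v (none no-port) = idx3 (enc (isoA w)) (enc (isoA w)) (enc (isoB w))
      where w = isoIndex v (no-port⇒isolated v no-port)

    readoutAt : Fin k → Fin (m ℕ.* m ℕ.* m)
    readoutAt v = readout v (findLeast (λ j → colour j ≟ v))

    formAt-readout : ∀ v r → formAt (readout v r) ≡ varᶠ v
    formAt-readout v (least j cj≡v _) =
      trans (formAt-enc (port j) (port (next j)) (edge (edgeOf j)))
            (trans (find-here _≟ₑ²_ zeroᶠ (port (next j) , edge (edgeOf j)) (varᶠ (colour j))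
                              (((port j , port j) , compᶠ (colour j)) ∷ []))
                   (cong varᶠ cj≡v))
    formAt-readout v (none no-port) =
      trans (formAt-enc (isoA w) (isoA w) (isoB w))
            (trans (find-here _≟ₑ²_ zeroᶠ (isoA w , isoB w) (varᶠ (iso w))
                              (((isoA w , isoA w) , compᶠ (iso w)) ∷ []))
                   (cong varᶠ (iso-isoIndex v v-iso)))
      where
      v-iso = no-port⇒isolated v no-port
      w = isoIndex v v-iso

    formAt-readoutAt : ∀ v → formAt (readoutAt v) ≡ varᶠ v
    formAt-readoutAt v = formAt-readout v (findLeast (λ j → colour j ≟ v))

    project : Pt (m ℕ.* m ℕ.* m) → Pt k
    project = affMap (δ ∘ readoutAt) (λ _ → 0ℚ)

    project-readout : ∀ y v → project y v ≡ y (readoutAt v)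
    project-readout y v = trans (ℚ.+-identityʳ _) (sumFin-δ (readoutAt v) y)

    project∘embed : ∀ x → project (embed x) ≈ₚ x
    project∘embed x v = begin
      project (embed x) v                ≡⟨ project-readout (embed x) v ⟩
      embed x (readoutAt v)              ≡⟨ embed-eval x (readoutAt v) ⟩
      eval (formAt (readoutAt v)) x      ≡⟨ cong (λ φ → eval φ x) (formAt-readoutAt v) ⟩
      x v                                ∎
      where open ≡-Reasoning

    -- α · y ≤ 0 cuts out the face on which all coordinates outside the entries vanish.
    α : Pt (m ℕ.* m ℕ.* m)
    α i = - 𝟙 (zeroᶠ? (formAt i))

    α≤0 : ∀ i → α i ≤ 0ℚ
    α≤0 i with zeroᶠ? (formAt i)
    ... | yes _ = ℚ.neg-antimono-≤ 0≤1
    ... | no _  = ℚ.≤-refl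

    α·embed : ∀ x → α · embed x ≡ 0ℚ
    α·embed x = sumFin-zero λ i → trans (cong (α i *_) (embed-eval x i)) (vanish i (zeroᶠ? (formAt i)))
      where
      vanish : ∀ i (d : Dec (formAt i ≡ zeroᶠ)) → - 𝟙 d * eval (formAt i) x ≡ 0ℚ
      vanish i (yes φ≡0) = cong (λ φ → - 1ℚ * eval φ x) φ≡0
      vanish i (no _)    = ℚ.*-zeroˡ (eval (formAt i) x)

    α-term≤0 : ∀ (y : Pt (m ℕ.* m ℕ.* m)) → (∀ i → 0ℚ ≤ y i) → ∀ i → α i * y i ≤ 0ℚ
    α-term≤0 y y≥0 i = ℚ.≤-trans (ℚ.≤-reflexive (ℚ.*-comm (α i) (y i))) (nonneg*nonpos≤0 (y≥0 i) (α≤0 i))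

    α-valid : ∀ y → (∀ i → 0ℚ ≤ y i) → α · y ≤ 0ℚ
    α-valid y y≥0 = sumFin-nonpos (α-term≤0 y y≥0)

    on-face⇒vanishes : ∀ y → (∀ i → 0ℚ ≤ y i) → α · y ≡ 0ℚ → ∀ i → formAt i ≡ zeroᶠ → y i ≡ 0ℚ
    on-face⇒vanishes y y≥0 α·y≡0 i φ≡0 = *-zero-cancelʳ (trans (ℚ.*-comm (y i) (α i)) αy≡0) α≢0
      where
      αy≡0 : α i * y i ≡ 0ℚ
      αy≡0 = sumFin-nonpos-zero (α-term≤0 y y≥0) α·y≡0 i
      α≢0 : α i ≢ 0ℚ
      α≢0 α≡0 with trans (sym (cong -_ (𝟙-yes (zeroᶠ? (formAt i)) φ≡0))) α≡0
      ... | ()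

    𝟙-decode : ∀ t u A B → 𝟙 ((dec t , dec u) ≟ₑ² (A , B)) ≡ δ (enc A) t * δ (enc B) u
    𝟙-decode t u A B =
      trans (𝟙-cong (λ eq → let t≡A , u≡B = ,-injective eq in to-enc t≡A , to-enc u≡B)
                    (λ (At , Bu) → cong₂ _,_ (from-enc At) (from-enc Bu))
                    ((dec t , dec u) ≟ₑ² (A , B)) ((enc A ≟ t) ×-dec (enc B ≟ u)))
            (𝟙-× (enc A ≟ t) (enc B ≟ u))
      where
      to-enc : ∀ {s S} → dec s ≡ S → enc S ≡ s
      to-enc {s} refl = enc-dec s
      from-enc : ∀ {s S} → enc S ≡ s → dec s ≡ S
      from-enc {S = S} refl = dec-enc S

    module StableSet (b : Fin k → Bool)
                     (stable : ∀ i → b (colour (endA i)) ≡ true → b (colour (endB i)) ≡ false) where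

      χ : Pt k
      χ v = if b v then 1ℚ else 0ℚ

      σ σ⁻¹ τ : El → El
      σ (port j) = if b (colour j) then port (next j) else port j
      σ S        = S
      σ⁻¹ (port j) = if b (colour j) then port (prev j) else port j
      σ⁻¹ S        = S
      τ (port j) = if b (colour j) then edge (edgeOf j) else port j
      τ (edge i) = if b (colour (endA i)) then port (endA i)
                   else if b (colour (endB i)) then port (endB i) else edge i
      τ (isoA w) = if b (iso w) then isoB w else isoA w
      τ (isoB w) = if b (iso w) then isoA w else isoB w

      σ⁻¹∘σ : ∀ S → σ⁻¹ (σ S) ≡ S
      σ⁻¹∘σ (port j) = go (b (colour j)) refl
        where
        go : ∀ β → b (colour j) ≡ β → σ⁻¹ (if β then port (next j) else port j) ≡ port j
        go true  bj = trans (if-cong (trans (cong b (colour-next j)) bj)) (cong port (prev-next j))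
        go false bj = if-cong bj
      σ⁻¹∘σ (edge _) = refl
      σ⁻¹∘σ (isoA _) = refl
      σ⁻¹∘σ (isoB _) = refl

      σ∘σ⁻¹ : ∀ S → σ (σ⁻¹ S) ≡ S
      σ∘σ⁻¹ (port j) = go (b (colour j)) refl
        where
        go : ∀ β → b (colour j) ≡ β → σ (if β then port (prev j) else port j) ≡ port j
        go true  bj = trans (if-cong (trans (cong b (colour-prev j)) bj)) (cong port (next-prev j))
        go false bj = if-cong bj
      σ∘σ⁻¹ (edge _) = refl
      σ∘σ⁻¹ (isoA _) = refl
      σ∘σ⁻¹ (isoB _) = refl

      -- τ is an involution because, by stability, no edge has both ends in b.
      τ∘τ : ∀ S → τ (τ S) ≡ S
      τ∘τ (port j) = go (b (colour j)) refl (endA-or-endB j)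
        where
        go : ∀ β → b (colour j) ≡ β → j ≡ endA (edgeOf j) ⊎ j ≡ endB (edgeOf j) →
             τ (if β then edge (edgeOf j) else port j) ≡ port j
        go false bj _ = if-cong bj
        go true bj (inj₁ j≡A) = trans (if-cong (trans (cong (b ∘ colour) (sym j≡A)) bj))
                                      (cong port (sym j≡A))
        go true bj (inj₂ j≡B) with b (colour (endA (edgeOf j))) in ba
        ... | true  = case trans (sym (stable (edgeOf j) ba)) (trans (cong (b ∘ colour) (sym j≡B)) bj)
                        of λ ()
        ... | false = trans (if-cong (trans (cong (b ∘ colour) (sym j≡B)) bj)) (cong port (sym j≡B))
      τ∘τ (edge i) = go (b (colour (endA i))) (b (colour (endB i))) refl refl
        where
        go : ∀ βA βB → b (colour (endA i)) ≡ βA → b (colour (endB i)) ≡ βB →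
             τ (if βA then port (endA i) else if βB then port (endB i) else edge i) ≡ edge i
        go true  _     bA _  = trans (if-cong bA) (cong edge (edgeOf-endA i))
        go false true  _  bB = trans (if-cong bB) (cong edge (edgeOf-endB i))
        go false false bA bB = trans (if-cong bA) (if-cong bB)
      τ∘τ (isoA w) = go (b (iso w)) refl
        where
        go : ∀ β → b (iso w) ≡ β → τ (if β then isoB w else isoA w) ≡ isoA w
        go true  bw = if-cong bw
        go false bw = if-cong bw
      τ∘τ (isoB w) = go (b (iso w)) refl
        where
        go : ∀ β → b (iso w) ≡ β → τ (if β then isoA w else isoB w) ≡ isoB w
        go true  bw = if-cong bw
        go false bw = if-cong bw

      target : El → El × El
      target S = σ S , τ S

      target∈support : ∀ S → target S ∈ support S
      target∈support (port j) with b (colour j)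
      ... | true  = here refl
      ... | false = there (here refl)
      target∈support (edge i) with b (colour (endA i))
      ... | true = here refl
      ... | false with b (colour (endB i))
      ...   | true  = there (here refl)
      ...   | false = there (there (here refl))
      target∈support (isoA w) with b (iso w)
      ... | true  = here refl
      ... | false = there (here refl)
      target∈support (isoB w) with b (iso w)
      ... | true  = here refl
      ... | false = there (here refl)

      χ≡ : ∀ {v β} → b v ≡ β → (if β then 1ℚ else 0ℚ) ≡ χ v
      χ≡ bv = sym (if-cong bv)

      1-χ≡ : ∀ {v β} → b v ≡ β → 1ℚ - (if β then 1ℚ else 0ℚ) ≡ 1ℚ - χ v
      1-χ≡ bv = cong (λ y → 1ℚ - y) (χ≡ bv)

      1-χ-χ≡ : ∀ {v v′ β β′} → b v ≡ β → b v′ ≡ β′ →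
               1ℚ - (if β then 1ℚ else 0ℚ) - (if β′ then 1ℚ else 0ℚ) ≡ 1ℚ - χ v - χ v′
      1-χ-χ≡ bv bv′ = cong₂ (λ y z → 1ℚ - y - z) (χ≡ bv) (χ≡ bv′)

      hit : ∀ {K} → 𝟙 (K ≟ₑ² K) ≡ 1ℚ
      hit {K} = 𝟙-yes (K ≟ₑ² K) refl

      miss : ∀ {k K} → k ≢ K → 𝟙 (k ≟ₑ² K) ≡ 0ℚ
      miss {k} {K} = 𝟙-no (k ≟ₑ² K)

      entry-indicator : ∀ S → All (λ (key , φ) → 𝟙 (key ≟ₑ² target S) ≡ eval φ χ) (entries S)
      entry-indicator (port j) with b (colour j) in bj
      ... | true  = trans hit (χ≡ bj) ∷ trans (miss λ ()) (1-χ≡ bj) ∷ []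
      ... | false = trans (miss λ ()) (χ≡ bj) ∷ trans hit (1-χ≡ bj) ∷ []
      entry-indicator (edge i) with b (colour (endA i)) in bA | b (colour (endB i)) in bB
      ... | true  | true  = case trans (sym (stable i bA)) bB of λ ()
      ... | true  | false = trans hit (χ≡ bA)
                          ∷ trans (miss (port-endA≢port-endB i ∘ sym ∘ ,-injectiveʳ)) (χ≡ bB)
                          ∷ trans (miss λ ()) (1-χ-χ≡ bA bB) ∷ []
      ... | false | true  = trans (miss (port-endA≢port-endB i ∘ ,-injectiveʳ)) (χ≡ bA)
                          ∷ trans hit (χ≡ bB)
                          ∷ trans (miss λ ()) (1-χ-χ≡ bA bB) ∷ []
      ... | false | false = trans (miss λ ()) (χ≡ bA)
                          ∷ trans (miss λ ()) (χ≡ bB)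
                          ∷ trans hit (1-χ-χ≡ bA bB) ∷ []
      entry-indicator (isoA w) with b (iso w) in bw
      ... | true  = trans hit (χ≡ bw) ∷ trans (miss λ ()) (1-χ≡ bw) ∷ []
      ... | false = trans (miss λ ()) (χ≡ bw) ∷ trans hit (1-χ≡ bw) ∷ []
      entry-indicator (isoB w) with b (iso w) in bw
      ... | true  = trans hit (χ≡ bw) ∷ trans (miss λ ()) (1-χ≡ bw) ∷ []
      ... | false = trans (miss λ ()) (χ≡ bw) ∷ trans hit (1-χ≡ bw) ∷ []

      eval-form : ∀ S T U → eval (form S T U) χ ≡ 𝟙 ((T , U) ≟ₑ² target S)
      eval-form S T U = sym (find-spec _≟ₑ²_ zeroᶠ (λ φ → eval φ χ) (λ key → 𝟙 (key ≟ₑ² target S))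
                                       (entries S) (entry-indicator S) (T , U) off-support)
        where
        off-support : (T , U) ∉ support S → 𝟙 ((T , U) ≟ₑ² target S) ≡ 0ℚ
        off-support ∉ = miss λ { refl → ∉ (target∈support S) }

      embed-vertex : ∀ x → x ≈ₚ χ → TAPVert m (embed x)
      embed-vertex x x≈χ = permutation-vertex (conjugate (mk↔ₛ′ σ σ⁻¹ σ∘σ⁻¹ σ⁻¹∘σ))
                                              (conjugate (mk↔ₛ′ τ τ τ∘τ τ∘τ)) (embed x) λ s t u →
        begin
          embed x (idx3 s t u)                       ≡⟨ embed-eval x (idx3 s t u) ⟩
          eval (formAt (idx3 s t u)) x               ≡⟨ cong (λ φ → eval φ x) (formAt-idx3 s t u) ⟩
          eval (form (dec s) (dec t) (dec u)) x      ≡⟨ eval-cong (form (dec s) (dec t) (dec u)) x≈χ ⟩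
          eval (form (dec s) (dec t) (dec u)) χ      ≡⟨ eval-form (dec s) (dec t) (dec u) ⟩
          𝟙 ((dec t , dec u) ≟ₑ² target (dec s))     ≡⟨ 𝟙-decode t u (σ (dec s)) (τ (dec s)) ⟩
          δ (enc (σ (dec s))) t * δ (enc (τ (dec s))) u ∎
        where open ≡-Reasoning

    sumFin²-support-El : (G : Fin m → Fin m → ℚ) (F : El → El → Form k) →
      (∀ T U → F T U ≡ zeroᶠ → G (enc T) (enc U) ≡ 0ℚ) →
      (ks : List (El × El)) → Unique ks → (∀ T U → F T U ≡ zeroᶠ ⊎ (T , U) ∈ ks) →
      sumFin (λ t → sumFin (λ u → G t u)) ≡ sumList (map (λ (T , U) → G (enc T) (enc U)) ks)
    sumFin²-support-El G F G-vanish ks ks! F⊆ks =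
      trans (sumFin²-support G (map encPair ks) (Unique.map⁺ encPair-injective ks!) G⊆ks)
            (cong sumList (sym (map-∘ ks)))
      where
      encPair : El × El → Fin m × Fin m
      encPair (T , U) = enc T , enc U

      encPair-injective : ∀ {k k′} → encPair k ≡ encPair k′ → k ≡ k′
      encPair-injective eq = let T≡ , U≡ = ,-injective eq
                             in cong₂ _,_ (enc-injective T≡) (enc-injective U≡)

      G⊆ks : ∀ t u → G t u ≡ 0ℚ ⊎ (t , u) ∈ map encPair ks
      G⊆ks t u with F⊆ks (dec t) (dec u)
      ... | inj₁ F≡0 = inj₁ (subst₂ (λ t u → G t u ≡ 0ℚ) (enc-dec t) (enc-dec u) (G-vanish _ _ F≡0))
      ... | inj₂ ∈ks = inj₂ (subst (_∈ map encPair ks) (cong₂ _,_ (enc-dec t) (enc-dec u))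
                                   (∈-map⁺ encPair ∈ks))

    column-support : ∀ j S U → form S (port j) U ≡ zeroᶠ ⊎
                     (S , U) ∈ (port j , port j) ∷ (port (prev j) , edge (edgeOf (prev j))) ∷ []
    column-support j S U with form-zero-or-support S (port j) U
    ... | inj₁ F≡0 = inj₁ F≡0
    column-support _ (port j′) _ | inj₂ (here refl) =
      inj₂ (there (here (cong (λ z → port z , edge (edgeOf z)) (sym (prev-next j′)))))
    column-support _ (port j′) _ | inj₂ (there (here refl)) = inj₂ (here refl)
    column-support _ (edge i) _ | inj₂ (here ())
    column-support _ (edge i) _ | inj₂ (there (here ()))
    column-support _ (edge i) _ | inj₂ (there (there (here ())))
    column-support _ (isoA w) _ | inj₂ (here ())
    column-support _ (isoA w) _ | inj₂ (there (here ()))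
    column-support _ (isoB w) _ | inj₂ (here ())
    column-support _ (isoB w) _ | inj₂ (there (here ()))

    depth-support-port : ∀ j S T → form S T (port j) ≡ zeroᶠ ⊎
                         (S , T) ∈ (port j , port j) ∷ (edge (edgeOf j) , edge (edgeOf j)) ∷ []
    depth-support-port j S T with form-zero-or-support S T (port j)
    ... | inj₁ F≡0 = inj₁ F≡0
    depth-support-port _ (port j′) _ | inj₂ (here ())
    depth-support-port _ (port j′) _ | inj₂ (there (here refl)) = inj₂ (here refl)
    depth-support-port _ (edge i) _ | inj₂ (here refl) =
      inj₂ (there (here (cong (λ z → edge z , edge z) (sym (edgeOf-endA i)))))
    depth-support-port _ (edge i) _ | inj₂ (there (here refl)) =
      inj₂ (there (here (cong (λ z → edge z , edge z) (sym (edgeOf-endB i)))))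
    depth-support-port _ (edge i) _ | inj₂ (there (there (here ())))
    depth-support-port _ (isoA w) _ | inj₂ (here ())
    depth-support-port _ (isoA w) _ | inj₂ (there (here ()))
    depth-support-port _ (isoB w) _ | inj₂ (here ())
    depth-support-port _ (isoB w) _ | inj₂ (there (here ()))

    depth-support-iso : ∀ w S T → form S T (isoA w) ≡ zeroᶠ ⊎
                        (S , T) ∈ (isoA w , isoA w) ∷ (isoB w , isoB w) ∷ []
    depth-support-iso w S T with form-zero-or-support S T (isoA w)
    ... | inj₁ F≡0 = inj₁ F≡0
    depth-support-iso _ (port j) _ | inj₂ (here ())
    depth-support-iso _ (port j) _ | inj₂ (there (here ()))
    depth-support-iso _ (edge i) _ | inj₂ (here ())
    depth-support-iso _ (edge i) _ | inj₂ (there (here ()))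
    depth-support-iso _ (edge i) _ | inj₂ (there (there (here ())))
    depth-support-iso _ (isoA w′) _ | inj₂ (here ())
    depth-support-iso _ (isoA w′) _ | inj₂ (there (here refl)) = inj₂ (here refl)
    depth-support-iso _ (isoB w′) _ | inj₂ (here refl) = inj₂ (there (here refl))
    depth-support-iso _ (isoB w′) _ | inj₂ (there (here ()))

    module FaceVertex (p : Pt (m ℕ.* m ℕ.* m)) (p-vertex : TAPVert m p)
                      (p-face : ∀ i → formAt i ≡ zeroᶠ → p i ≡ 0ℚ) where

      P : El → El → El → ℚ
      P S T U = p (idx3 (enc S) (enc T) (enc U))

      x : Pt k
      x = project p

      P-vanish : ∀ S T U → form S T U ≡ zeroᶠ → P S T U ≡ 0ℚ
      P-vanish S T U F≡0 = p-face _ (trans (formAt-enc S T U) F≡0)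

      row : ∀ S → sumList (map (λ (T , U) → P S T U) (support S)) ≡ 1ℚ
      row S = trans (sym (sumFin²-support-El (λ t u → p (idx3 (enc S) t u)) (form S) (P-vanish S)
                                             (support S) (support-unique S) (form-zero-or-support S)))
                    (proj₂ (proj₂ (proj₂ p-vertex)) (enc S))

      column : ∀ T ks → Unique ks → (∀ S U → form S T U ≡ zeroᶠ ⊎ (S , U) ∈ ks) →
               sumList (map (λ (S , U) → P S T U) ks) ≡ 1ℚ
      column T ks ks! support =
        trans (sym (sumFin²-support-El (λ s u → p (idx3 s (enc T) u)) (λ S U → form S T U)
                                       (λ S U → P-vanish S T U) ks ks! support))
              (proj₁ (proj₂ (proj₂ p-vertex)) (enc T))

      depth : ∀ U ks → Unique ks → (∀ S T → form S T U ≡ zeroᶠ ⊎ (S , T) ∈ ks) →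
              sumList (map (λ (S , T) → P S T U) ks) ≡ 1ℚ
      depth U ks ks! support =
        trans (sym (sumFin²-support-El (λ s t → p (idx3 s t (enc U))) (λ S T → form S T U)
                                       (λ S T → P-vanish S T U) ks ks! support))
              (proj₁ (proj₂ p-vertex) (enc U))

      X Y : Port → ℚ
      X j = P (port j) (port (next j)) (edge (edgeOf j))
      Y j = P (port j) (port j) (port j)

      -- Row and column sums through port j force X to be invariant under the cyclic order,
      -- hence constant on the ports of each vertex.
      X-prev : ∀ j → X (prev j) ≡ X j
      X-prev j = trans (cong (λ z → P (port (prev j)) (port z) (edge (edgeOf (prev j)))) (next-prev j))
                       (partners-agree (X j) (Y j) (P (port (prev j)) (port j) (edge (edgeOf (prev j))))
                                       (row (port j))
                                       (column (port j) _ (unique₂ λ ()) (column-support j)))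

      X≡x : ∀ j → X j ≡ x (colour j)
      X≡x j = trans (go (findLeast (λ j′ → colour j′ ≟ colour j))) (sym (project-readout p (colour j)))
        where
        go : ∀ r → X j ≡ p (readout (colour j) r)
        go (least j₀ cj₀ _) = prev-invariant⇒constant X X-prev (sym cj₀)
        go (none no-port)   = ⊥-elim (no-port j refl)

      iso≡x : ∀ w → P (isoA w) (isoA w) (isoB w) ≡ x (iso w)
      iso≡x w = trans (go (findLeast (λ j → colour j ≟ iso w))) (sym (project-readout p (iso w)))
        where
        go : ∀ r → P (isoA w) (isoA w) (isoB w) ≡ p (readout (iso w) r)
        go (least j cj _) = ⊥-elim (isolated⇒no-port (iso w) (iso-isolated w) j cj)
        go (none no-port) = cong (λ w′ → P (isoA w′) (isoA w′) (isoB w′))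
                                 (sym (isoIndex-iso w (no-port⇒isolated (iso w) no-port)))

      edge-end : ∀ i j → j ≡ endA i ⊎ j ≡ endB i → P (edge i) (edge i) (port j) ≡ x (colour j)
      edge-end i j j∈i =
        trans (partners-agree (X j) (Y j) (P (edge i) (edge i) (port j)) (row (port j)) depth-j) (X≡x j)
        where
        edgeOf-j : edgeOf j ≡ i
        edgeOf-j = [ (λ { refl → edgeOf-endA i }) , (λ { refl → edgeOf-endB i }) ]′ j∈i
        depth-j : sumList (Y j ∷ P (edge i) (edge i) (port j) ∷ []) ≡ 1ℚ
        depth-j = subst (λ e → sumList (Y j ∷ P (edge e) (edge e) (port j) ∷ []) ≡ 1ℚ) edgeOf-j
                        (depth (port j) _ (unique₂ λ ()) (depth-support-port j))

      edge-centre : ∀ i → P (edge i) (edge i) (edge i) ≡ 1ℚ - x (colour (endA i)) - x (colour (endB i))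
      edge-centre i =
        trans (third-of-triple (P (edge i) (edge i) (port (endA i))) (P (edge i) (edge i) (port (endB i)))
                               (P (edge i) (edge i) (edge i)) (row (edge i)))
              (cong₂ (λ a b → 1ℚ - a - b) (edge-end i (endA i) (inj₁ refl)) (edge-end i (endB i) (inj₂ refl)))

      entry-value : ∀ S → All (λ ((T , U) , φ) → P S T U ≡ eval φ x) (entries S)
      entry-value (port j) =
        X≡x j ∷ trans (second-of-pair (X j) (Y j) (row (port j))) (cong (λ y → 1ℚ - y) (X≡x j)) ∷ []
      entry-value (edge i) =
        edge-end i (endA i) (inj₁ refl) ∷ edge-end i (endB i) (inj₂ refl) ∷ edge-centre i ∷ []
      entry-value (isoA w) =
        iso≡x w ∷
        trans (second-of-pair (P (isoA w) (isoA w) (isoB w)) (P (isoA w) (isoA w) (isoA w)) (row (isoA w)))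
              (cong (λ y → 1ℚ - y) (iso≡x w)) ∷ []
      entry-value (isoB w) =
        BBA≡x ∷
        trans (second-of-pair (P (isoB w) (isoB w) (isoA w)) (P (isoB w) (isoB w) (isoB w)) (row (isoB w)))
              (cong (λ y → 1ℚ - y) BBA≡x) ∷ []
        where
        BBA≡x : P (isoB w) (isoB w) (isoA w) ≡ x (iso w)
        BBA≡x = trans (partners-agree (P (isoA w) (isoA w) (isoB w)) (P (isoA w) (isoA w) (isoA w))
                                      (P (isoB w) (isoB w) (isoA w)) (row (isoA w))
                                      (depth (isoA w) _ (unique₂ λ ()) (depth-support-iso w)))
                      (iso≡x w)

      P≡eval : ∀ S T U → P S T U ≡ eval (form S T U) x
      P≡eval S T U = find-spec _≟ₑ²_ zeroᶠ (λ φ → eval φ x) (λ key → P S (proj₁ key) (proj₂ key))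
                               (entries S) (entry-value S) (T , U) off-support
        where
        off-support : (T , U) ∉ support S → P S T U ≡ 0ℚ
        off-support ∉ with form-zero-or-support S T U
        ... | inj₁ F≡0 = P-vanish S T U F≡0
        ... | inj₂ ∈   = ⊥-elim (∉ ∈)

      embed∘project : embed x ≈ₚ p
      embed∘project = ∀-idx3 {m} λ s t u → begin
        embed x (idx3 s t u)                      ≡⟨ embed-eval x (idx3 s t u) ⟩
        eval (formAt (idx3 s t u)) x              ≡⟨ cong (λ φ → eval φ x) (formAt-idx3 s t u) ⟩
        eval (form (dec s) (dec t) (dec u)) x     ≡⟨ sym (P≡eval (dec s) (dec t) (dec u)) ⟩
        p (idx3 (enc (dec s)) (enc (dec t)) (enc (dec u)))
          ≡⟨ cong₃ (λ a b c → p (idx3 a b c)) (enc-dec s) (enc-dec t) (enc-dec u) ⟩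
        p (idx3 s t u)                            ∎
        where open ≡-Reasoning

      project-stable : StableVec E x
      project-stable =
        (λ v → subst (λ y → y ≡ 0ℚ ⊎ y ≡ 1ℚ) (sym (project-readout p v)) (proj₁ p-vertex (readoutAt v))) ,
        All.tabulate edge-condition
        where
        edge-condition : ∀ {e} → e ∈ E → x (proj₁ e) + x (proj₂ e) ≤ 1ℚ
        edge-condition e∈E with index e∈E | lookup-index e∈E
        ... | i | refl =
          subst₂ (λ a b → x a + x b ≤ 1ℚ) (colour-endA i) (colour-endB i)
                 (complement≤1 (x (colour (endA i))) (x (colour (endB i))) (P (edge i) (edge i) (edge i))
                               (01⇒nonneg (proj₁ p-vertex _)) (edge-centre i))

    stable⇒face-vertex : ∀ x → StableVec E x → FaceBy (TAPVert m) α 0ℚ (embed x)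
    stable⇒face-vertex x (x01 , x-edges) =
      StableSet.embed-vertex b stable x (λ v → x≈χ v (x v ℚ.≟ 1ℚ)) , α·embed x
      where
      b : Fin k → Bool
      b v = does (x v ℚ.≟ 1ℚ)

      x≈χ : ∀ v (d : Dec (x v ≡ 1ℚ)) → x v ≡ (if does d then 1ℚ else 0ℚ)
      x≈χ v (yes x≡1) = x≡1
      x≈χ v (no x≢1) with x01 v
      ... | inj₁ x≡0 = x≡0
      ... | inj₂ x≡1 = ⊥-elim (x≢1 x≡1)

      edge-sum : ∀ i → x (colour (endA i)) + x (colour (endB i)) ≤ 1ℚ
      edge-sum i = subst₂ (λ a c → x a + x c ≤ 1ℚ) (sym (colour-endA i)) (sym (colour-endB i))
                          (All.lookup x-edges (∈-lookup {xs = E} i))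

      stable : ∀ i → b (colour (endA i)) ≡ true → b (colour (endB i)) ≡ false
      stable i = go (x (colour (endA i)) ℚ.≟ 1ℚ)
        where
        go : (d : Dec (x (colour (endA i)) ≡ 1ℚ)) → does d ≡ true → b (colour (endB i)) ≡ false
        go (yes xA≡1) _ = dec-false (x (colour (endB i)) ℚ.≟ 1ℚ) λ xB≡1 →
          2≰1 (subst₂ (λ a c → a + c ≤ 1ℚ) xA≡1 xB≡1 (edge-sum i))
        go (no _) ()

    vertex-nonneg : ∀ y → TAPVert m y → ∀ i → 0ℚ ≤ y i
    vertex-nonneg y y-vertex = 01⇒nonneg ∘ proj₁ y-vertex

    α-valid-on-TAP : ∀ y → TAP m y → α · y ≤ 0ℚ
    α-valid-on-TAP y y∈TAP = α-valid y (hull-nonneg vertex-nonneg y y∈TAP)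

    face-vertex⇒stable : ∀ y → FaceBy (TAPVert m) α 0ℚ y →
                         StableVec E (project y) × embed (project y) ≈ₚ y
    face-vertex⇒stable y (y-vertex , α·y≡0) = FaceVertex.project-stable y y-vertex y-face ,
                                              FaceVertex.embed∘project y y-vertex y-face
      where y-face = on-face⇒vanishes y (vertex-nonneg y y-vertex) α·y≡0

    face≐hull : FaceBy (TAP m) α 0ℚ ≐ ConvHull (FaceBy (TAPVert m) α 0ℚ)
    face≐hull = face-of-hull⊆hull-of-face {V = TAPVert m} {α} {0ℚ}
                  (λ y y-vertex → α-valid y (vertex-nonneg y y-vertex))
                  (stable⇒face-vertex (λ _ → 0ℚ) empty-stable) ,
                hull-of-face⊆face-of-hull {V = TAPVert m} {α} {0ℚ}
      where
      empty-stable : StableVec E (λ _ → 0ℚ)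
      empty-stable = (λ _ → inj₁ refl) , All.tabulate (λ _ → 0≤1)

open import Data.Nat using (ℕ; _+_; _*_)
open import Data.Product using (_,_)
open import Data.Rational using (0ℚ)
open import Function using (_∘_)

theorem7 : (k : ℕ) (E : List (Edge k)) → IsSimpleGraph E →
    SSP E ≤A TAP (3 * length E + 2 * numIsolated E)
theorem7 k E _ =
  α , 0ℚ , α-valid-on-TAP ,
  affEquiv-from-points (coeff ∘ formAt) (const ∘ formAt) (δ ∘ readoutAt) (λ _ → 0ℚ)
    project∘embed stable⇒face-vertex face-vertex⇒stable face≐hull
  where open Construction E
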